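{- Let $a,b\ge0$, $n\ge1$ and $T\in\mathrm{SHST}(a,b,n)$. Then \[ \mathrm{charge}(T)=\bigl((a+b+2)a+1\bigr)n-\mathrm{sum}_1(T), \] where $\mathrm{sum}_1(T)$ is the sum of all entries in the first row of $T$.
   Context: $\mathrm{SHST}(a,b,n)$ is the set of semistandard Young tableaux of shape $(n(a+1),n^b)$ with each of $1,\dots,a+b+1$ occurring exactly $n$ times. $\mathrm{charge}(T)=\mathrm{charge}(\mathrm{rw}(T))$, where the reading word lists entries row by row, left to right, bottom row first. For a permutation $\pi$ of $[r]$, $\mathrm{charge}(\pi)=\mathrm{maj}(\mathrm{rev}(\pi^{ -1}))$ (maj = sum of descent positions, rev = reversal). A word with partition content $(v_1,\dots)$ is split into $v_1$ standard subwords (take the rightmost $1$, move left to the first $2$, then the first $3$, etc., wrapping to the right end when needed, as long as possible; repeat on unused letters), and its charge is the sum of the charges of the subwords. -}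

module Defs where

open import Data.Nat using (ℕ; zero; suc; _+_; _*_; _≤_; _<_; _≡ᵇ_; _<ᵇ_)
open import Data.Bool using (Bool; true; false; if_then_else_; _∨_)
open import Data.List using (List; []; _∷_; length; map; concat; reverse; replicate; upTo; _++_)
open import Data.Nat.ListAction using (sum)
open import Data.Maybe using (Maybe; just; nothing)
open import Relation.Binary.PropositionalEquality using (_≡_)

-- i-th element (0-based), 0 if out of range
at : List ℕ → ℕ → ℕ
at []       _       = 0
at (x ∷ _)  zero    = x
at (_ ∷ xs) (suc i) = at xs i

-- i-th row (0-based), [] if out of range
rowAt : List (List ℕ) → ℕ → List ℕ
rowAt []       _       = []
rowAt (r ∷ _)  zero    = r
rowAt (_ ∷ rs) (suc i) = rowAt rs i

count : ℕ → List ℕ → ℕ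
count k []       = 0
count k (x ∷ xs) = (if x ≡ᵇ k then 1 else 0) + count k xs

filterᵇ : {A : Set} → (A → Bool) → List A → List A
filterᵇ p []       = []
filterᵇ p (x ∷ xs) = if p x then x ∷ filterᵇ p xs else filterᵇ p xs

memᵇ : ℕ → List ℕ → Bool
memᵇ i []       = false
memᵇ i (x ∷ xs) = (i ≡ᵇ x) ∨ memᵇ i xs

lastM : List ℕ → Maybe ℕ
lastM []           = nothing
lastM (x ∷ [])     = just x
lastM (_ ∷ y ∷ ys) = lastM (y ∷ ys)

-- 1-based index of the first occurrence of k in a list (0 if absent)
indexOf : ℕ → List ℕ → ℕ
indexOf k []       = 0
indexOf k (x ∷ xs) = if x ≡ᵇ k then 1 else suc (indexOf k xs)

majFrom : ℕ → List ℕ → ℕ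
majFrom i []           = 0
majFrom i (x ∷ [])     = 0
majFrom i (x ∷ y ∷ zs) = (if y <ᵇ x then i else 0) + majFrom (suc i) (y ∷ zs)

maj : List ℕ → ℕ
maj = majFrom 1

oneTo : ℕ → List ℕ
oneTo m = map suc (upTo m)

-- inverse of a permutation π of [m] given in one-line notation
invPerm : List ℕ → List ℕ
invPerm π = map (λ k → indexOf k π) (oneTo (length π))

chargePerm : List ℕ → ℕ
chargePerm π = maj (reverse (invPerm π))

-- Charge of a word with partition content, via standard subwords.
-- Positions are 0-based; `avail` is the ascending list of unused positions.

withLetter : List ℕ → ℕ → List ℕ → List ℕ
withLetter w k avail = filterᵇ (λ i → at w i ≡ᵇ k) avail

-- starting at position p (holding letter k-1), find the next letter k:
-- first unused k to the left of p, otherwise (wrapping) the rightmost unused k.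
nextPos : List ℕ → ℕ → List ℕ → ℕ → Maybe ℕ
nextPos w k avail p with lastM (filterᵇ (λ i → i <ᵇ p) (withLetter w k avail))
... | just q  = just q
... | nothing = lastM (withLetter w k avail)

collect : ℕ → List ℕ → List ℕ → ℕ → ℕ → List ℕ
collect zero       w avail k p = []
collect (suc fuel) w avail k p with nextPos w k avail p
... | nothing = []
... | just q  = q ∷ collect fuel w avail (suc k) q

extract : List ℕ → List ℕ → List ℕ
extract w avail with lastM (withLetter w 1 avail)
... | nothing = []
... | just p  = p ∷ collect (length w) w avail 2 p

subwordOf : List ℕ → List ℕ → List ℕ
subwordOf w sel = map (at w) (filterᵇ (λ i → memᵇ i sel) (upTo (length w)))

chargeLoop : ℕ → List ℕ → List ℕ → ℕ
chargeLoop zero       w avail = 0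
chargeLoop (suc fuel) w avail with extract w avail
... | []      = 0
... | p ∷ ps  = chargePerm (subwordOf w (p ∷ ps))
                + chargeLoop fuel w (filterᵇ (λ i → if memᵇ i (p ∷ ps) then false else true) avail)

chargeWord : List ℕ → ℕ
chargeWord w = chargeLoop (length w) w (upTo (length w))

-- Tableaux: a list of rows, top row first (English convention).

readingWord : List (List ℕ) → List ℕ
readingWord T = concat (reverse T)

chargeT : List (List ℕ) → ℕ
chargeT T = chargeWord (readingWord T)

sum₁ : List (List ℕ) → ℕ
sum₁ T = sum (rowAt T 0)

record IsSSYT (T : List (List ℕ)) : Set where
  field
    rowWeak   : ∀ i j → suc j < length (rowAt T i) →
                at (rowAt T i) j ≤ at (rowAt T i) (suc j)
    colStrict : ∀ i j → j < length (rowAt T (suc i)) →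
                at (rowAt T i) j < at (rowAt T (suc i)) j

record SHST (a b n : ℕ) (T : List (List ℕ)) : Set where
  field
    ssyt    : IsSSYT T
    shape   : map length T ≡ (n * (a + 1)) ∷ replicate b n
    content : ∀ k → 1 ≤ k → k ≤ a + b + 1 → count k (concat T) ≡ n

module Submission where

-- Let m = a+b+1 and let w be the reading word of T, in which every letter of
-- [1, m] occurs n times.  The proof rests on a general description of the
-- charge of such a word (chargeWord-excess): writing E k for the maximal
-- excess of the letters k-1 over the letters k in a prefix of w,
--     chargeWord w = Σ_{k=2}^{m} (m+1-k) · E k.
-- Each extracted standard subword contributes the weights m+1-k of the
-- letters k reached by wrapping around from k-1 (subword-charge), and each
-- extraction lowers E k by exactly one for these k and leaves it unchanged
-- otherwise (maxExcess-leftward, maxExcess-wrapped).  For the tableau, column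
-- strictness shows that E k is the number of k's in the first row
-- (tableau-excess) and that all n ones lie in the first row.  With
-- t k = count k (first row), the theorem becomes the identity
--     Σ_{k≥2} (m+1-k) t k + m · t 1 + Σ_k k · t k = (m+1) · n(a+1).

open import Defs
open import Data.Nat using (ℕ; zero; suc; _+_; _*_; _∸_; _≤_; _<_; z≤n; s≤s; _<ᵇ_; _≡ᵇ_; pred)
open import Data.Nat.Properties
open import Data.Bool using (Bool; true; false; if_then_else_)
open import Data.Bool.Properties using (T-≡)
open import Function using (id)
open import Function.Bundles using (Equivalence)
open import Data.List using (List; []; _∷_; length; map; concat; reverse; replicate; upTo; _++_; take; drop; applyUpTo)
open import Data.List.Properties using (length-map; map-∘; length-reverse; reverse-++; length-++; length-applyUpTo; ++-identityʳ; take++drop≡id; concat-++; map-upTo; map-id; ∷-injective; length-replicate)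
open import Data.Nat.ListAction using (sum)
open import Data.List.Relation.Unary.All as All using (All; []; _∷_)
open import Data.List.Relation.Unary.All.Properties using (++⁻ʳ; map⁺)
open import Data.List.Membership.Propositional using (_∈_)
open import Data.List.Membership.Propositional.Properties using (∈-upTo⁺)
open import Data.List.Relation.Unary.Any using (here; there)
open import Data.Maybe using (just; nothing)
open import Data.Product using (Σ; _×_; _,_; proj₁; proj₂)
open import Data.Empty using (⊥-elim)
open import Data.Sum using (_⊎_; inj₁; inj₂)
open import Relation.Nullary using (¬_)
open import Relation.Binary.PropositionalEquality
open import Relation.Binary using (tri<; tri≈; tri>)
open import Data.Nat.Tactic.RingSolver using (solve-∀)
open import Algebra.Properties.CommutativeSemigroup +-commutativeSemigroup using (interchange)

ι : Bool → ℕ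
ι b = if b then 1 else 0

<ᵇ-true : ∀ {m n} → m < n → (m <ᵇ n) ≡ true
<ᵇ-true p = Equivalence.to T-≡ (<⇒<ᵇ p)

<ᵇ-true⁻¹ : ∀ {m n} → (m <ᵇ n) ≡ true → m < n
<ᵇ-true⁻¹ {m} {n} e = <ᵇ⇒< m n (Equivalence.from T-≡ e)

<ᵇ-false : ∀ {m n} → ¬ (m < n) → (m <ᵇ n) ≡ false
<ᵇ-false {m} {n} m≮n with m <ᵇ n in eq
... | true  = ⊥-elim (m≮n (<ᵇ-true⁻¹ eq))
... | false = refl

<ᵇ-false⁻¹ : ∀ {m n} → (m <ᵇ n) ≡ false → ¬ (m < n)
<ᵇ-false⁻¹ e p with trans (sym (<ᵇ-true p)) e
... | ()

≡ᵇ-true : ∀ {m n} → m ≡ n → (m ≡ᵇ n) ≡ true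
≡ᵇ-true {m} {n} p = Equivalence.to T-≡ (≡⇒≡ᵇ m n p)

≡ᵇ-true⁻¹ : ∀ {m n} → (m ≡ᵇ n) ≡ true → m ≡ n
≡ᵇ-true⁻¹ {m} {n} e = ≡ᵇ⇒≡ m n (Equivalence.from T-≡ e)

≡ᵇ-false : ∀ {m n} → ¬ (m ≡ n) → (m ≡ᵇ n) ≡ false
≡ᵇ-false {m} {n} m≢n with m ≡ᵇ n in eq
... | true  = ⊥-elim (m≢n (≡ᵇ-true⁻¹ eq))
... | false = refl

≡ᵇ-false⁻¹ : ∀ {m n} → (m ≡ᵇ n) ≡ false → ¬ (m ≡ n)
≡ᵇ-false⁻¹ e p with trans (sym (≡ᵇ-true p)) e
... | ()

infixr 5 _∙_
_∙_ : ∀ {A : Set} {x y z : A} → x ≡ y → y ≡ z → x ≡ z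
_∙_ = trans

filter-length-∷ : ∀ (p : ℕ → Bool) x l → length (filterᵇ p (x ∷ l)) ≡ ι (p x) + length (filterᵇ p l)
filter-length-∷ p x l with p x
... | true  = refl
... | false = refl

filter-length-≤ : ∀ (p : ℕ → Bool) l → length (filterᵇ p l) ≤ length l
filter-length-≤ p [] = z≤n
filter-length-≤ p (x ∷ l) with p x
... | true  = s≤s (filter-length-≤ p l)
... | false = m≤n⇒m≤1+n (filter-length-≤ p l)

filter-comm : ∀ (p q : ℕ → Bool) l → filterᵇ p (filterᵇ q l) ≡ filterᵇ q (filterᵇ p l)
filter-comm p q [] = refl
filter-comm p q (x ∷ l) with q x in eq | p x in ep
... | true  | true  rewrite eq | ep = cong (x ∷_) (filter-comm p q l)
... | true  | false rewrite ep = filter-comm p q l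
... | false | true  rewrite eq = filter-comm p q l
... | false | false = filter-comm p q l

filter-cong : ∀ (p q : ℕ → Bool) l → All (λ x → p x ≡ q x) l → filterᵇ p l ≡ filterᵇ q l
filter-cong p q [] [] = refl
filter-cong p q (x ∷ l) (e ∷ es) rewrite e with q x
... | true  = cong (x ∷_) (filter-cong p q l es)
... | false = filter-cong p q l es

All-filter : ∀ {P : ℕ → Set} (p : ℕ → Bool) {l} → All P l → All P (filterᵇ p l)
All-filter p [] = []
All-filter p {x ∷ l} (a ∷ as) with p x
... | true  = a ∷ All-filter p as
... | false = All-filter p as

filter-sat : ∀ (p : ℕ → Bool) l → All (λ x → p x ≡ true) (filterᵇ p l)
filter-sat p [] = []
filter-sat p (x ∷ l) with p x in eq
... | true  = eq ∷ filter-sat p l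
... | false = filter-sat p l

filter-⊆ : ∀ (p : ℕ → Bool) {x} l → x ∈ filterᵇ p l → x ∈ l
filter-⊆ p (y ∷ l) m with p y
filter-⊆ p (y ∷ l) (here e)  | true = here e
filter-⊆ p (y ∷ l) (there m) | true = there (filter-⊆ p l m)
... | false = there (filter-⊆ p l m)

∈-filter : ∀ (p : ℕ → Bool) {x} l → x ∈ l → p x ≡ true → x ∈ filterᵇ p l
∈-filter p (y ∷ l) (here refl) e rewrite e = here refl
∈-filter p (y ∷ l) (there m) e with p y
... | true  = there (∈-filter p l m e)
... | false = ∈-filter p l m e

data Ascending : List ℕ → Set where
  []  : Ascending []
  _∷_ : ∀ {x xs} → All (x <_) xs → Ascending xs → Ascending (x ∷ xs)

Ascending-filter : ∀ (p : ℕ → Bool) {l} → Ascending l → Ascending (filterᵇ p l)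
Ascending-filter p [] = []
Ascending-filter p {x ∷ l} (a ∷ s) with p x
... | true  = All-filter p a ∷ Ascending-filter p s
... | false = Ascending-filter p s

Ascending-upTo : ∀ L → Ascending (upTo L)
Ascending-upTo L = go id L (λ h → h)
  where
  All-applyUpTo : ∀ {P : ℕ → Set} (f : ℕ → ℕ) L → (∀ i → P (f i)) → All P (applyUpTo f L)
  All-applyUpTo f zero    h = []
  All-applyUpTo f (suc L) h = h 0 ∷ All-applyUpTo (λ i → f (suc i)) L (λ i → h (suc i))
  go : ∀ (f : ℕ → ℕ) L → (∀ {i j} → i < j → f i < f j) → Ascending (applyUpTo f L)
  go f zero    h = []
  go f (suc L) h = All-applyUpTo (λ i → f (suc i)) L (λ i → h (s≤s z≤n)) ∷ go (λ i → f (suc i)) L (λ l → h (s≤s l))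

count-none : ∀ x l → All (λ y → ¬ (y ≡ x)) l → count x l ≡ 0
count-none x [] [] = refl
count-none x (y ∷ l) (y≢x ∷ as) rewrite ≡ᵇ-false y≢x = count-none x l as

count-ascending : ∀ {x l} → Ascending l → x ∈ l → count x l ≡ 1
count-ascending (_∷_ {y} {ys} a s) (here refl) rewrite ≡ᵇ-true {y} {y} refl =
  cong suc (count-none y ys (All.map (λ y<z z≡y → <-irrefl (sym z≡y) y<z) a))
count-ascending {x} (_∷_ {y} a s) (there m) rewrite ≡ᵇ-false {y} {x} (λ e → <-irrefl e (All.lookup a m)) =
  count-ascending s m

count-++ : ∀ k u v → count k (u ++ v) ≡ count k u + count k v
count-++ k [] v = refl
count-++ k (x ∷ u) v rewrite count-++ k u v = sym (+-assoc (ι (x ≡ᵇ k)) _ _)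

count-take-drop : ∀ k X (l : List ℕ) → count k l ≡ count k (take X l) + count k (drop X l)
count-take-drop k X l = cong (count k) (sym (take++drop≡id X l)) ∙ count-++ k (take X l) (drop X l)

count-drop-≤ : ∀ k X (l : List ℕ) → count k (drop X l) ≤ count k l
count-drop-≤ k X l = subst (count k (drop X l) ≤_) (sym (count-take-drop k X l)) (m≤n+m _ _)

count-take-≤ : ∀ k X (l : List ℕ) → count k (take X l) ≤ count k l
count-take-≤ k X l = subst (count k (take X l) ≤_) (sym (count-take-drop k X l)) (m≤m+n _ _)

-- below X l: the number of entries of l that are smaller than X.
-- On a set of positions this is the rank of X; on a word it counts the
-- letters below X.

below : ℕ → List ℕ → ℕ
below X l = length (filterᵇ (λ i → i <ᵇ X) l)

below-∷ : ∀ X x l → below X (x ∷ l) ≡ ι (x <ᵇ X) + below X l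
below-∷ X x l = filter-length-∷ (λ i → i <ᵇ X) x l

ι-<ᵇ-suc : ∀ x X → ι (x <ᵇ suc X) ≡ ι (x <ᵇ X) + ι (x ≡ᵇ X)
ι-<ᵇ-suc x X with <-cmp x X
... | tri< x<X x≢X _ rewrite <ᵇ-true x<X | <ᵇ-true (m<n⇒m<1+n x<X) | ≡ᵇ-false x≢X = refl
... | tri≈ _ refl _  rewrite <ᵇ-true (n<1+n x) | <ᵇ-false (<-irrefl {x} refl) | ≡ᵇ-true {x} refl = refl
... | tri> _ x≢X X<x rewrite <ᵇ-false (<⇒≯ X<x) | <ᵇ-false (λ h → <-irrefl refl (≤-trans X<x (≤-pred h))) | ≡ᵇ-false x≢X = refl

below-suc : ∀ X l → below (suc X) l ≡ below X l + count X l
below-suc X [] = refl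
below-suc X (x ∷ l) rewrite below-∷ (suc X) x l | below-∷ X x l | below-suc X l | ι-<ᵇ-suc x X =
  interchange (ι (x <ᵇ X)) (ι (x ≡ᵇ X)) (below X l) (count X l)

ι-<ᵇ-mono : ∀ x {X Y} → X ≤ Y → ι (x <ᵇ X) ≤ ι (x <ᵇ Y)
ι-<ᵇ-mono x {X} X≤Y with x <ᵇ X in e
... | false = z≤n
... | true rewrite <ᵇ-true (<-≤-trans (<ᵇ-true⁻¹ e) X≤Y) = ≤-refl

below-mono : ∀ {X Y} l → X ≤ Y → below X l ≤ below Y l
below-mono [] le = z≤n
below-mono {X} {Y} (x ∷ l) le rewrite below-∷ X x l | below-∷ Y x l = +-mono-≤ (ι-<ᵇ-mono x le) (below-mono l le)

below-≤-length : ∀ X l → below X l ≤ length l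
below-≤-length X l = filter-length-≤ (λ i → i <ᵇ X) l

below-all : ∀ X l → All (_< X) l → below X l ≡ length l
below-all X [] [] = refl
below-all X (x ∷ l) (a ∷ as) rewrite below-∷ X x l | <ᵇ-true a = cong suc (below-all X l as)

below-none : ∀ X l → All (X ≤_) l → below X l ≡ 0
below-none X [] [] = refl
below-none X (x ∷ l) (a ∷ as) rewrite below-∷ X x l | <ᵇ-false (≤⇒≯ a) = below-none X l as

without : ℕ → ℕ → Bool
without q i = if i ≡ᵇ q then false else true

below-without : ∀ X q l → below X l ≡ below X (filterᵇ (without q) l) + (if q <ᵇ X then count q l else 0)
below-without X q [] with q <ᵇ X
... | true  = refl
... | false = refl
below-without X q (x ∷ l) with x ≡ᵇ q in e
... | true with ≡ᵇ-true⁻¹ {x} {q} e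
...   | refl rewrite below-∷ X x l | below-without X x l with x <ᵇ X
...     | true  = sym (+-suc _ _)
...     | false = refl
below-without X q (x ∷ l) | false rewrite below-∷ X x l | below-∷ X x (filterᵇ (without q) l) | below-without X q l =
  sym (+-assoc (ι (x <ᵇ X)) _ _)

length-without : ∀ q l → length l ≡ length (filterᵇ (without q) l) + count q l
length-without q [] = refl
length-without q (x ∷ l) with x ≡ᵇ q
... | true  = cong suc (length-without q l) ∙ sym (+-suc _ _)
... | false = cong suc (length-without q l)

below-strict : ∀ {q q'} S → q ∈ S → q < q' → suc (below q S) ≤ below q' S
below-strict {q} {q'} (s ∷ S) (here refl) h rewrite below-∷ q s S | below-∷ q' s S | <ᵇ-false (<-irrefl {s} refl) | <ᵇ-true h =
  s≤s (below-mono S (<⇒≤ h))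
below-strict {q} {q'} (s ∷ S) (there m) h rewrite below-∷ q s S | below-∷ q' s S =
  ≤-trans (≤-reflexive (sym (+-suc (ι (s <ᵇ q)) (below q S)))) (+-mono-≤ (ι-<ᵇ-mono s (<⇒≤ h)) (below-strict S m h))

lastM-∈ : ∀ {q} l → lastM l ≡ just q → q ∈ l
lastM-∈ (x ∷ []) refl = here refl
lastM-∈ (x ∷ y ∷ l) e = there (lastM-∈ (y ∷ l) e)

lastM-max : ∀ {q} l → Ascending l → lastM l ≡ just q → All (_< suc q) l
lastM-max (x ∷ []) s refl = ≤-refl ∷ []
lastM-max (x ∷ y ∷ l) (a ∷ s) e = m<n⇒m<1+n (All.lookup a (lastM-∈ (y ∷ l) e)) ∷ lastM-max (y ∷ l) s e

lastM-nothing : ∀ l → lastM l ≡ nothing → l ≡ []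
lastM-nothing [] e = refl
lastM-nothing (x ∷ []) ()
lastM-nothing (x ∷ y ∷ l) e with lastM-nothing (y ∷ l) e
... | ()

lastM-∷ : ∀ x l → Σ ℕ (λ q → lastM (x ∷ l) ≡ just q)
lastM-∷ x [] = x , refl
lastM-∷ x (y ∷ l) = lastM-∷ y l

withLetter-∈ : ∀ w k avail {q} → q ∈ withLetter w k avail → (at w q ≡ k) × (q ∈ avail)
withLetter-∈ w k avail m =
  ≡ᵇ-true⁻¹ (All.lookup (filter-sat (λ i → at w i ≡ᵇ k) avail) m) , filter-⊆ (λ i → at w i ≡ᵇ k) avail m

withLetter-ascending : ∀ w k {avail} → Ascending avail → Ascending (withLetter w k avail)
withLetter-ascending w k s = Ascending-filter (λ i → at w i ≡ᵇ k) s

-- The two ways the reading head moves from the letter k-1 at p to the letter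
-- k at q, described through the rank function of the positions holding k:
-- either q is the nearest k to the left of p, or there is no k to the left of
-- p and the head wraps around to the rightmost k.
data NextStep (L : List ℕ) (p q : ℕ) : Set where
  leftward : q < p → below p L ≡ below (suc q) L → NextStep L p q
  wrapped  : p < q → below p L ≡ 0 → below (suc q) L ≡ length L → NextStep L p q

module _ (w : List ℕ) (k : ℕ) (avail : List ℕ) (p : ℕ) where

  private
    L : List ℕ
    L = withLetter w k avail
    L<p : List ℕ
    L<p = filterᵇ (λ i → i <ᵇ p) L

  nextPos-found : ∀ {q} → lastM L<p ≡ just q → nextPos w k avail p ≡ just q
  nextPos-found e rewrite e = refl

  nextPos-wraps : lastM L<p ≡ nothing → nextPos w k avail p ≡ lastM L
  nextPos-wraps e rewrite e = refl

  nextPos-defined : 0 < length L → Σ ℕ (λ q → nextPos w k avail p ≡ just q)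
  nextPos-defined h = go (lastM L<p) refl
    where
    go : ∀ r → lastM L<p ≡ r → Σ ℕ (λ q → nextPos w k avail p ≡ just q)
    go (just q) e = q , nextPos-found e
    go nothing e with L | nextPos-wraps e
    ... | x ∷ l | e' = proj₁ (lastM-∷ x l) , e' ∙ proj₂ (lastM-∷ x l)

  nextPos-undefined : L ≡ [] → nextPos w k avail p ≡ nothing
  nextPos-undefined L≡[] = go (lastM L<p) refl
    where
    go : ∀ r → lastM L<p ≡ r → nextPos w k avail p ≡ nothing
    go (just q) e with trans (sym (cong (λ l → lastM (filterᵇ (λ i → i <ᵇ p) l)) L≡[])) e
    ... | ()
    go nothing e = nextPos-wraps e ∙ cong lastM L≡[]

  nextPos-spec : ∀ {q} → Ascending avail → ¬ (at w p ≡ k) → nextPos w k avail p ≡ just q → (q ∈ L) × NextStep L p q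
  nextPos-spec {q} asc p≢k e = go (lastM L<p) refl
    where
    go : ∀ r → lastM L<p ≡ r → (q ∈ L) × NextStep L p q
    go (just q') e1 with trans (sym (nextPos-found e1)) e
    ... | refl = q∈L , leftward q<p (cong length (sym (filter-cong _ _ L (All.tabulate same-below))))
      where
      q∈L<p : q ∈ L<p
      q∈L<p = lastM-∈ L<p e1
      q∈L : q ∈ L
      q∈L = filter-⊆ _ L q∈L<p
      q<p : q < p
      q<p = <ᵇ-true⁻¹ (All.lookup (filter-sat _ L) q∈L<p)
      maximal : All (_< suc q) L<p
      maximal = lastM-max L<p (Ascending-filter _ (withLetter-ascending w k asc)) e1
      same-below : ∀ {i} → i ∈ L → (i <ᵇ suc q) ≡ (i <ᵇ p)
      same-below {i} m with i <ᵇ p in ei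
      ... | true  = <ᵇ-true (All.lookup maximal (∈-filter _ L m ei))
      ... | false = <ᵇ-false (λ h → <ᵇ-false⁻¹ ei (≤-<-trans (≤-pred h) q<p))
    go nothing e1 =
      q∈L , wrapped p<q (cong length (lastM-nothing L<p e1)) (below-all (suc q) L (lastM-max L (withLetter-ascending w k asc) lastL))
      where
      lastL : lastM L ≡ just q
      lastL = sym (nextPos-wraps e1) ∙ e
      q∈L : q ∈ L
      q∈L = lastM-∈ L lastL
      q≮p : ¬ (q < p)
      q≮p q<p with subst (q ∈_) (lastM-nothing _ e1) (∈-filter (λ i → i <ᵇ p) L q∈L (<ᵇ-true q<p))
      ... | ()
      p<q : p < q
      p<q with <-cmp p q
      ... | tri< p<q _ _ = p<q
      ... | tri≈ _ refl _ = ⊥-elim (p≢k (proj₁ (withLetter-∈ w k avail q∈L)))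
      ... | tri> _ _ q<p = ⊥-elim (q≮p q<p)

data Trail (w avail : List ℕ) : ℕ → ℕ → List ℕ → Set where
  []  : ∀ {k p} → Trail w avail k p []
  _∷_ : ∀ {k p q l} → nextPos w k avail p ≡ just q → Trail w avail (suc k) q l → Trail w avail k p (q ∷ l)

-- The visited positions, indexed: the j-th step goes from the (j-1)-th
-- position (p for j = 0) to the j-th one, looking for the letter k + j.
Trail-at : ∀ {w avail k p l} → Trail w avail k p l →
  ∀ j → j < length l → nextPos w (k + j) avail (at (p ∷ l) j) ≡ just (at l j)
Trail-at {w} {avail} {k} {p} (_∷_ {q = q} e t) zero h =
  subst (λ a → nextPos w a avail p ≡ just q) (sym (+-identityʳ k)) e
Trail-at {w} {avail} {k} {p} (_∷_ {q = q} {l = l} e t) (suc j) h =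
  subst (λ a → nextPos w a avail (at (q ∷ l) j) ≡ just (at l j)) (sym (+-suc k j)) (Trail-at t j (≤-pred h))

collect-trail : ∀ fuel w avail k p → Trail w avail k p (collect fuel w avail k p)
collect-trail zero w avail k p = []
collect-trail (suc fuel) w avail k p with nextPos w k avail p in e
... | nothing = []
... | just q  = e ∷ collect-trail fuel w avail (suc k) q

collect-undefined : ∀ fuel w avail k p → nextPos w k avail p ≡ nothing → collect fuel w avail k p ≡ []
collect-undefined zero       w avail k p e = refl
collect-undefined (suc fuel) w avail k p e rewrite e = refl

collect-length : ∀ w avail m fuel k p → k ≤ suc m → suc m ≤ fuel + k →
  (∀ j → k ≤ j → j ≤ m → 0 < length (withLetter w j avail)) → withLetter w (suc m) avail ≡ [] →
  length (collect fuel w avail k p) ≡ suc m ∸ k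
collect-length w avail m fuel k p k≤ fuel≥ available exhausted with m≤n⇒m<n∨m≡n k≤
... | inj₂ refl = cong length (collect-undefined fuel w avail (suc m) p (nextPos-undefined w (suc m) avail p exhausted))
                  ∙ sym (n∸n≡0 m)
collect-length w avail m zero k p k≤ fuel≥ available exhausted | inj₁ k≤m = ⊥-elim (<-irrefl refl (≤-<-trans fuel≥ k≤m))
collect-length w avail m (suc fuel) k p k≤ fuel≥ available exhausted | inj₁ k≤m
  with nextPos-defined w k avail p (available k ≤-refl (≤-pred k≤m))
... | q , e rewrite e =
  cong suc (collect-length w avail m fuel (suc k) q k≤m (subst (suc m ≤_) (sym (+-suc fuel k)) fuel≥)
                           (λ j k<j j≤m → available j (<⇒≤ k<j) j≤m) exhausted)
  ∙ sym (+-∸-assoc 1 (≤-pred k≤m))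

extract-found : ∀ w avail q → lastM (withLetter w 1 avail) ≡ just q → extract w avail ≡ q ∷ collect (length w) w avail 2 q
extract-found w avail q e rewrite e = refl

extract-none : ∀ w avail → lastM (withLetter w 1 avail) ≡ nothing → extract w avail ≡ []
extract-none w avail e rewrite e = refl

unselected : List ℕ → ℕ → Bool
unselected sel i = if memᵇ i sel then false else true

chargeLoop-step : ∀ fuel w avail p ps → extract w avail ≡ p ∷ ps →
  chargeLoop (suc fuel) w avail ≡ chargePerm (subwordOf w (p ∷ ps)) + chargeLoop fuel w (filterᵇ (unselected (p ∷ ps)) avail)
chargeLoop-step fuel w avail p ps e rewrite e = refl

chargeLoop-done : ∀ fuel w avail → extract w avail ≡ [] → chargeLoop fuel w avail ≡ 0
chargeLoop-done zero       w avail e = refl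
chargeLoop-done (suc fuel) w avail e rewrite e = refl

-- For counting functions fA, fB (fA X = number of letters k-1 before X,
-- fB X = number of letters k before X), MaxExcess fA fB W says that W is the
-- maximum over X of fA X - fB X.  This number is what the extraction of
-- standard subwords decrements: each time the head wraps around from k-1 to
-- k, W drops by one, and otherwise it is unchanged.

MaxExcess : (ℕ → ℕ) → (ℕ → ℕ) → ℕ → Set
MaxExcess fA fB W = (∀ X → fA X ≤ fB X + W) × Σ ℕ (λ X → fA X ≡ fB X + W)

Monotone : (ℕ → ℕ) → Set
Monotone f = ∀ {X Y} → X ≤ Y → f X ≤ f Y

ι-≤ : ∀ {p X} → X ≤ p → ι (p <ᵇ X) ≡ 0
ι-≤ h rewrite <ᵇ-false (≤⇒≯ h) = refl

ι-< : ∀ {p X} → p < X → ι (p <ᵇ X) ≡ 1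
ι-< h rewrite <ᵇ-true h = refl

three-ways : ∀ q p X → q < p → (X ≤ q) ⊎ ((q < X × X ≤ p) ⊎ (p < X))
three-ways q p X q<p with ≤-<-connex X q
... | inj₁ a = inj₁ a
... | inj₂ b with ≤-<-connex X p
...   | inj₁ c = inj₂ (inj₁ (b , c))
...   | inj₂ d = inj₂ (inj₂ d)

cancel-one : ∀ x y W → x + 1 ≤ y + 1 + W → x ≤ y + W
cancel-one x y W h rewrite +-comm x 1 | +-comm y 1 = ≤-pred h

-- Removing a letter k-1 at p (fA jumps at p) and the nearest k to its left,
-- at q < p (fB is flat on (q, p]), leaves the maximal excess unchanged.
maxExcess-leftward : ∀ (fA fB fA' fB' : ℕ → ℕ) p q W →
  Monotone fA → Monotone fB → fA (suc p) ≡ suc (fA p) → fB (suc p) ≡ fB p → q < p → fB p ≡ fB (suc q) →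
  (∀ X → fA X ≡ fA' X + ι (p <ᵇ X)) → (∀ X → fB X ≡ fB' X + ι (q <ᵇ X)) →
  MaxExcess fA fB W → MaxExcess fA' fB' W
maxExcess-leftward fA fB fA' fB' p q W monoA monoB jumpA flatB q<p flat splitA splitB (bound , X₀ , attained) = bound' , attained'
  where
  flat-gap : ∀ X → q < X → X ≤ p → fB X ≡ fB p
  flat-gap X slack h2 = ≤-antisym (monoB h2) (subst (_≤ fB X) (sym flat) (monoB slack))
  gap-slack : ∀ X → q < X → X ≤ p → suc (fA X) ≤ fB X + W
  gap-slack X slack h2 = ≤-trans (s≤s (monoA h2)) (subst (_≤ fB X + W) jumpA (≤-trans (bound (suc p)) (≤-reflexive (cong (_+ W) (trans flatB (sym (flat-gap X slack h2)))))))
  bound' : ∀ X → fA' X ≤ fB' X + W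
  -- Before q nothing changes; on (q, p] the slack at p+1 pays for the removed k;
  -- after p both counts drop by one.
  bound' X with three-ways q p X q<p
  ... | inj₁ a = subst₂ _≤_ (trans (splitA X) (cong (fA' X +_) (ι-≤ (≤-trans a (<⇒≤ q<p))) ∙ +-identityʳ _))
                           (cong (_+ W) (trans (splitB X) (cong (fB' X +_) (ι-≤ a) ∙ +-identityʳ _))) (bound X)
  ... | inj₂ (inj₁ (b , c)) = cancel-one (fA' X) (fB' X) W (subst₂ _≤_ (trans (cong suc (splitA X)) (cong (λ z → suc (fA' X + z)) (ι-≤ c) ∙ cong suc (+-identityʳ _) ∙ +-comm 1 _))
                              (cong (_+ W) (trans (splitB X) (cong (fB' X +_) (ι-< b)))) (gap-slack X b c))
  ... | inj₂ (inj₂ d) = cancel-one (fA' X) (fB' X) W (subst₂ _≤_ (trans (splitA X) (cong (fA' X +_) (ι-< d)))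
                              (cong (_+ W) (trans (splitB X) (cong (fB' X +_) (ι-< (<-trans q<p d))))) (bound X))
  attained' : Σ ℕ (λ X → fA' X ≡ fB' X + W)
  attained' with three-ways q p X₀ q<p
  ... | inj₁ a = X₀ , trans (sym (trans (splitA X₀) (trans (cong (fA' X₀ +_) (ι-≤ (≤-trans a (<⇒≤ q<p)))) (+-identityʳ _))))
                      (trans attained (cong (_+ W) (trans (splitB X₀) (trans (cong (fB' X₀ +_) (ι-≤ a)) (+-identityʳ _)))))
  ... | inj₂ (inj₁ (b , c)) = ⊥-elim (<-irrefl refl (subst (suc (fA X₀) ≤_) (sym attained) (gap-slack X₀ b c)))
  ... | inj₂ (inj₂ d) = X₀ , +-cancelʳ-≡ 1 _ _ (trans (sym (trans (splitA X₀) (cong (fA' X₀ +_) (ι-< d))))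
                      (trans attained (trans (cong (_+ W) (trans (splitB X₀) (cong (fB' X₀ +_) (ι-< (<-trans q<p d)))))
                        (trans (+-assoc (fB' X₀) 1 W) (trans (cong (fB' X₀ +_) (+-comm 1 W)) (sym (+-assoc (fB' X₀) W 1)))))))

-- Removing a letter k-1 at p with no k before it and the last k, at q > p,
-- from equally many k-1's and k's lowers the maximal excess by one.
maxExcess-wrapped : ∀ (fA fB fA' fB' : ℕ → ℕ) p q W totA totB →
  Monotone fA → Monotone fB → fA (suc p) ≡ suc (fA p) → fB (suc p) ≡ fB p → p < q → fB p ≡ 0 → fB (suc q) ≡ totB →
  (∀ X → fB X ≤ totB) → (∀ X → fA X ≤ totA) → totA ≡ totB →
  (∀ X → fA X ≡ fA' X + ι (p <ᵇ X)) → (∀ X → fB X ≡ fB' X + ι (q <ᵇ X)) →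
  MaxExcess fA fB W → Σ ℕ (λ W' → (W ≡ suc W') × MaxExcess fA' fB' W')
maxExcess-wrapped fA fB fA' fB' p q W totA totB monoA monoB jumpA flatB p<q no-k-before last-q boundB boundA balanced splitA splitB (bound , X₀ , attained) = go W refl
  where
  slack : suc (fA p) ≤ W
  slack = subst₂ _≤_ jumpA (cong (_+ W) (flatB ∙ no-k-before)) (bound (suc p))
  flat-gap : ∀ X → q < X → fB X ≡ totB
  flat-gap X h = ≤-antisym (boundB X) (subst (_≤ fB X) last-q (monoB h))
  none-before : ∀ X → X ≤ p → fB X ≡ 0
  none-before X h = n≤0⇒n≡0 (subst (fB X ≤_) no-k-before (monoB h))
  go : ∀ V → W ≡ V → Σ ℕ (λ W' → (W ≡ suc W') × MaxExcess fA' fB' W')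
  go zero e = ⊥-elim (<-irrefl refl (<-≤-trans (s≤s z≤n) (subst (suc (fA p) ≤_) e slack)))
  go (suc W') e = W' , e , bound' , attained'
    where
    fA-p≤W' : fA p ≤ W'
    fA-p≤W' = ≤-pred (subst (suc (fA p) ≤_) e slack)
    bound' : ∀ X → fA' X ≤ fB' X + W'
    -- Before p the excess is at most fA p < W; on (p, q] only a k-1 was removed;
    -- after q both words are exhausted.
    bound' X with three-ways p q X p<q
    ... | inj₁ a = ≤-trans (subst (_≤ fA p) (splitA X ∙ cong (fA' X +_) (ι-≤ a) ∙ +-identityʳ _) (monoA a)) (≤-trans fA-p≤W' (m≤n+m W' _))
    ... | inj₂ (inj₁ (b , c)) = cancel-one (fA' X) (fB' X) W' (subst₂ _≤_ (splitA X ∙ cong (fA' X +_) (ι-< b))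
          (cong (_+ W) (splitB X ∙ cong (fB' X +_) (ι-≤ c) ∙ +-identityʳ _) ∙ cong (fB' X +_) e ∙ sym (+-assoc (fB' X) 1 W')) (bound X))
    ... | inj₂ (inj₂ d) = ≤-trans (≤-pred (subst₂ _≤_ (splitA X ∙ cong (fA' X +_) (ι-< (<-trans p<q d)) ∙ +-comm (fA' X) 1)
          (balanced ∙ sym (flat-gap X d) ∙ splitB X ∙ cong (fB' X +_) (ι-< d) ∙ +-comm (fB' X) 1) (boundA X))) (m≤m+n (fB' X) W')
    attained' : Σ ℕ (λ X → fA' X ≡ fB' X + W')
    attained' with three-ways p q X₀ p<q
    ... | inj₁ a = ⊥-elim (<-irrefl refl (≤-<-trans (≤-trans (monoA a) fA-p≤W')
           (subst (W' <_) (sym (attained ∙ cong (_+ W) (none-before X₀ a) ∙ e)) (n<1+n W'))))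
    ... | inj₂ (inj₂ d) = ⊥-elim (<-irrefl refl (≤-<-trans (subst (_≤ fB X₀) attained (subst (fA X₀ ≤_) (balanced ∙ sym (flat-gap X₀ d)) (boundA X₀)))
           (subst (fB X₀ <_) (cong (fB X₀ +_) (sym e)) (m<m+n (fB X₀) (s≤s z≤n)))))
    ... | inj₂ (inj₁ (b , c)) = X₀ , +-cancelʳ-≡ 1 _ _ (sym (splitA X₀ ∙ cong (fA' X₀ +_) (ι-< b)) ∙ attained ∙
           cong (_+ W) (splitB X₀ ∙ cong (fB' X₀ +_) (ι-≤ c) ∙ +-identityʳ _) ∙ cong (fB' X₀ +_) e ∙ cong (fB' X₀ +_) (+-comm 1 W') ∙ sym (+-assoc (fB' X₀) W' 1))

maxExcess-empty : ∀ fA fB W → (∀ X → fA X ≡ 0) → (∀ X → fB X ≡ 0) → MaxExcess fA fB W → W ≡ 0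
maxExcess-empty fA fB W zA zB (_ , X0 , wit) = sym (sym (zA X0) ∙ wit ∙ cong (_+ W) (zB X0))


-- Writing x k for the position of the letter k in π, chargePerm π is the
-- major index of the reversed sequence x 1, …, x m, i.e. the sum of the
-- weights m+1-k over those k ∈ [2, m] that lie to the right of k-1.

-- chargeSum f m = Σ_{k=2}^{m} (m+1-k) · f k
chargeSum : (ℕ → ℕ) → ℕ → ℕ
chargeSum f zero          = 0
chargeSum f (suc zero)    = 0
chargeSum f (suc (suc m)) = f 2 * suc m + chargeSum (λ k → f (suc k)) (suc m)

chargeSum-cong : ∀ f g m → (∀ k → 2 ≤ k → k ≤ m → f k ≡ g k) → chargeSum f m ≡ chargeSum g m
chargeSum-cong f g zero          h = refl
chargeSum-cong f g (suc zero)    h = refl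
chargeSum-cong f g (suc (suc m)) h =
  cong₂ _+_ (cong (_* suc m) (h 2 (s≤s (s≤s z≤n)) (s≤s (s≤s z≤n))))
            (chargeSum-cong _ _ (suc m) (λ k 2≤k k≤m → h (suc k) (m≤n⇒m≤1+n 2≤k) (s≤s k≤m)))

chargeSum-+ : ∀ f g m → chargeSum (λ k → f k + g k) m ≡ chargeSum f m + chargeSum g m
chargeSum-+ f g zero          = refl
chargeSum-+ f g (suc zero)    = refl
chargeSum-+ f g (suc (suc m)) =
  cong₂ _+_ (*-distribʳ-+ (suc m) (f 2) (g 2)) (chargeSum-+ (λ k → f (suc k)) (λ k → g (suc k)) (suc m))
  ∙ interchange (f 2 * suc m) (g 2 * suc m) _ _

chargeSum-zero : ∀ m → chargeSum (λ _ → 0) m ≡ 0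
chargeSum-zero zero          = refl
chargeSum-zero (suc zero)    = refl
chargeSum-zero (suc (suc m)) = chargeSum-zero (suc m)

-- maj of the reversal, computed directly: a strict ascent x < y followed by
-- zs contributes 1 + length zs.
majRev : List ℕ → ℕ
majRev []           = 0
majRev (x ∷ [])     = 0
majRev (x ∷ y ∷ zs) = (if x <ᵇ y then suc (length zs) else 0) + majRev (y ∷ zs)

private
  head : List ℕ → ℕ
  head []      = 0
  head (x ∷ _) = x

  if-cong : ∀ (b : Bool) {x y : ℕ} → x ≡ y → (if b then x else 0) ≡ (if b then y else 0)
  if-cong b refl = refl

  majFrom-∷ : ∀ i a u t T → majFrom i (a ∷ (u ++ t ∷ T)) ≡ (if head (u ++ t ∷ T) <ᵇ a then i else 0) + majFrom (suc i) (u ++ t ∷ T)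
  majFrom-∷ i a []      t T = refl
  majFrom-∷ i a (b ∷ u) t T = refl

  head-++ : ∀ u z y → head (u ++ z ∷ y ∷ []) ≡ head (u ++ z ∷ [])
  head-++ []      z y = refl
  head-++ (b ∷ u) z y = refl

  majFrom-snoc : ∀ i u z y → majFrom i (u ++ z ∷ y ∷ []) ≡ majFrom i (u ++ z ∷ []) + (if y <ᵇ z then i + length u else 0)
  majFrom-snoc i [] z y with y <ᵇ z
  ... | true  = refl
  ... | false = refl
  majFrom-snoc i (a ∷ u) z y =
    majFrom-∷ i a u z (y ∷ [])
    ∙ cong₂ _+_ (cong (λ h → if h <ᵇ a then i else 0) (head-++ u z y)) (majFrom-snoc (suc i) u z y)
    ∙ sym (+-assoc (if head (u ++ z ∷ []) <ᵇ a then i else 0) _ _)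
    ∙ cong₂ _+_ (sym (majFrom-∷ i a u z [])) (if-cong (y <ᵇ z) (sym (+-suc i (length u))))

maj-reverse : ∀ l → maj (reverse l) ≡ majRev l
maj-reverse []           = refl
maj-reverse (x ∷ [])     = refl
maj-reverse (x ∷ y ∷ zs) =
  cong maj (reverse-++ (x ∷ y ∷ []) zs) ∙ majFrom-snoc 1 (reverse zs) y x
  ∙ cong₂ _+_ (cong maj (sym (reverse-++ (y ∷ []) zs)) ∙ maj-reverse (y ∷ zs))
              (if-cong (x <ᵇ y) (cong suc (length-reverse zs)))
  ∙ +-comm (majRev (y ∷ zs)) (if x <ᵇ y then suc (length zs) else 0)

oneTo-suc : ∀ (x : ℕ → ℕ) m → map x (oneTo (suc m)) ≡ x 1 ∷ map (λ k → x (suc k)) (oneTo m)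
oneTo-suc x m = cong (λ l → x 1 ∷ map x (map suc l)) (sym (map-upTo suc m)) ∙ cong (x 1 ∷_) (sym (map-∘ (oneTo m)))

length-oneTo : ∀ m → length (oneTo m) ≡ m
length-oneTo m = length-map suc (upTo m) ∙ length-applyUpTo id m

if-ι : ∀ b n → (if b then n else 0) ≡ ι b * n
if-ι true  n = sym (+-identityʳ n)
if-ι false n = refl

majRev-ascents : ∀ m (x : ℕ → ℕ) → majRev (map x (oneTo m)) ≡ chargeSum (λ k → ι (x (pred k) <ᵇ x k)) m
majRev-ascents zero          x = refl
majRev-ascents (suc zero)    x = refl
majRev-ascents (suc (suc m)) x =
  cong majRev (oneTo-suc x (suc m) ∙ cong (x 1 ∷_) (oneTo-suc (λ k → x (suc k)) m))
  ∙ cong₂ _+_ (if-ι (x 1 <ᵇ x 2) _ ∙ cong (λ z → ι (x 1 <ᵇ x 2) * suc z) (length-map _ (oneTo m) ∙ length-oneTo m))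
              (cong majRev (sym (oneTo-suc (λ k → x (suc k)) m)) ∙ majRev-ascents (suc m) (λ k → x (suc k))
               ∙ chargeSum-cong _ _ (suc m) (λ { (suc k) _ _ → refl }))

sumTo : (ℕ → ℕ) → ℕ → ℕ
sumTo f zero    = 0
sumTo f (suc m) = f 1 + sumTo (λ k → f (suc k)) m

sumTo-cong : ∀ f g m → (∀ k → 1 ≤ k → k ≤ m → f k ≡ g k) → sumTo f m ≡ sumTo g m
sumTo-cong f g zero    h = refl
sumTo-cong f g (suc m) h = cong₂ _+_ (h 1 ≤-refl (s≤s z≤n)) (sumTo-cong _ _ m (λ k _ k≤m → h (suc k) (s≤s z≤n) (s≤s k≤m)))

sumTo-+ : ∀ f g m → sumTo (λ k → f k + g k) m ≡ sumTo f m + sumTo g m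
sumTo-+ f g zero    = refl
sumTo-+ f g (suc m) = cong (f 1 + g 1 +_) (sumTo-+ (λ k → f (suc k)) (λ k → g (suc k)) m) ∙ interchange (f 1) (g 1) _ _

sumTo-* : ∀ c f m → sumTo (λ k → c * f k) m ≡ c * sumTo f m
sumTo-* c f zero    = sym (*-zeroʳ c)
sumTo-* c f (suc m) = cong (c * f 1 +_) (sumTo-* c (λ k → f (suc k)) m) ∙ sym (*-distribˡ-+ c (f 1) _)

sumTo-const : ∀ c m → sumTo (λ _ → c) m ≡ m * c
sumTo-const c zero    = refl
sumTo-const c (suc m) = cong (c +_) (sumTo-const c m)

sumTo-pick : ∀ (f : ℕ → ℕ) x m → x < m → sumTo (λ k → f k * ι (suc x ≡ᵇ k)) m ≡ f (suc x)
sumTo-pick f zero (suc m) h =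
  cong (f 1 * 1 +_) (sumTo-cong _ _ m (λ { (suc k) _ _ → *-zeroʳ (f (suc (suc k))) }) ∙ sumTo-const 0 m ∙ *-zeroʳ m)
  ∙ +-identityʳ _ ∙ *-identityʳ (f 1)
sumTo-pick f (suc x) (suc m) h =
  cong (_+ sumTo (λ k → f (suc k) * ι (suc x ≡ᵇ k)) m) (*-zeroʳ (f 1)) ∙ sumTo-pick (λ k → f (suc k)) x m (≤-pred h)

InRange : ℕ → ℕ → Set
InRange m x = (1 ≤ x) × (x ≤ m)

sum-by-letter : ∀ (f : ℕ → ℕ) m l → All (InRange m) l → sum (map f l) ≡ sumTo (λ k → f k * count k l) m
sum-by-letter f m [] [] = sym (sumTo-cong _ _ m (λ k _ _ → *-zeroʳ (f k)) ∙ sumTo-const 0 m ∙ *-zeroʳ m)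
sum-by-letter f m (suc x ∷ l) ((_ , x<m) ∷ hs) =
  cong₂ _+_ (sym (sumTo-pick f x m x<m)) (sum-by-letter f m l hs)
  ∙ sym (sumTo-+ _ _ m)
  ∙ sumTo-cong _ _ m (λ k _ _ → sym (*-distribˡ-+ (f k) (ι (suc x ≡ᵇ k)) (count k l)))

length-by-letter : ∀ m l → All (InRange m) l → length l ≡ sumTo (λ k → count k l) m
length-by-letter m l h = ones l ∙ sum-by-letter (λ _ → 1) m l h ∙ sumTo-cong _ _ m (λ k _ _ → *-identityˡ (count k l))
  where
  ones : ∀ l → length l ≡ sum (map (λ _ → 1) l)
  ones []      = refl
  ones (x ∷ l) = cong suc (ones l)

sum-by-letter-id : ∀ m l → All (InRange m) l → sum l ≡ sumTo (λ k → k * count k l) m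
sum-by-letter-id m l h = cong sum (sym (map-id l)) ∙ sum-by-letter id m l h

outside : ℕ → List ℕ → ℕ
outside m []      = 0
outside m (x ∷ l) = (if x ≡ᵇ 0 then 1 else ι (m <ᵇ x)) + outside m l

private
  sumTo-0 : ∀ m → sumTo (λ _ → 0) m ≡ 0
  sumTo-0 m = sumTo-const 0 m ∙ *-zeroʳ m

  sumTo-beyond : ∀ x m → m ≤ x → sumTo (λ k → ι (suc x ≡ᵇ k)) m ≡ 0
  sumTo-beyond x       zero    h       = refl
  sumTo-beyond (suc x) (suc m) (s≤s h) = sumTo-beyond x m h

  counted-once : ∀ x m → sumTo (λ k → ι (x ≡ᵇ k)) m + (if x ≡ᵇ 0 then 1 else ι (m <ᵇ x)) ≡ 1
  counted-once zero m = cong (_+ 1) (sumTo-cong _ _ m (λ { (suc k) _ _ → refl }) ∙ sumTo-0 m)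
  counted-once (suc x) m with <-≤-connex x m
  ... | inj₁ x<m rewrite <ᵇ-false {m} {suc x} (≤⇒≯ x<m) =
    +-identityʳ _ ∙ sumTo-cong _ _ m (λ k _ _ → sym (*-identityˡ _)) ∙ sumTo-pick (λ _ → 1) x m x<m
  ... | inj₂ m≤x rewrite <ᵇ-true {m} {suc x} (s≤s m≤x) = cong (_+ 1) (sumTo-beyond x m m≤x)

length-outside : ∀ m l → length l ≡ sumTo (λ k → count k l) m + outside m l
length-outside m [] = sym (+-identityʳ _ ∙ sumTo-0 m)
length-outside m (x ∷ l) =
  cong suc (length-outside m l)
  ∙ cong (_+ (sumTo (λ k → count k l) m + outside m l)) (sym (counted-once x m))
  ∙ interchange (sumTo (λ k → ι (x ≡ᵇ k)) m) (if x ≡ᵇ 0 then 1 else ι (m <ᵇ x)) (sumTo (λ k → count k l) m) (outside m l)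
  ∙ cong (_+ outside m (x ∷ l)) (sym (sumTo-+ _ _ m))

outside-zero : ∀ m l → outside m l ≡ 0 → All (InRange m) l
outside-zero m [] e = []
outside-zero m (zero ∷ l) ()
outside-zero m (suc x ∷ l) e with m <ᵇ suc x in e1
... | false = (s≤s z≤n , ≮⇒≥ (<ᵇ-false⁻¹ e1)) ∷ outside-zero m l e

alphabet-exhausted : ∀ m c l → length l ≡ m * c → (∀ k → 1 ≤ k → k ≤ m → count k l ≡ c) → All (InRange m) l
alphabet-exhausted m c l len cnt =
  outside-zero m l (+-cancelˡ-≡ (m * c) _ _
    (sym (cong (_+ outside m l) (sumTo-cong _ _ m cnt ∙ sumTo-const c m)) ∙ sym (length-outside m l) ∙ len ∙ sym (+-identityʳ (m * c))))

count-map : ∀ (g : ℕ → ℕ) k S → count k (map g S) ≡ length (filterᵇ (λ s → g s ≡ᵇ k) S)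
count-map g k [] = refl
count-map g k (s ∷ S) rewrite filter-length-∷ (λ s → g s ≡ᵇ k) s S = cong (ι (g s ≡ᵇ k) +_) (count-map g k S)

indexOf-rank : ∀ (w : List ℕ) k q S → Ascending S → q ∈ S → at w q ≡ k → (∀ {s} → s ∈ S → at w s ≡ k → s ≡ q) →
  indexOf k (map (at w) S) ≡ suc (below q S)
indexOf-rank w k q (s ∷ S) (a ∷ asc) (here refl) e unique
  rewrite ≡ᵇ-true e | below-∷ s s S | <ᵇ-false (<-irrefl {s} refl) | below-none s S (All.map <⇒≤ a) = refl
indexOf-rank w k q (s ∷ S) (a ∷ asc) (there m) e unique
  rewrite ≡ᵇ-false {at w s} {k} (λ e' → <-irrefl (unique (here refl) e') (All.lookup a m)) | below-∷ q s S | <ᵇ-true (All.lookup a m) =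
  cong suc (indexOf-rank w k q S asc m e (λ m' e' → unique (there m') e'))

rank-compare : ∀ S q q' → q ∈ S → q' ∈ S → ¬ (q ≡ q') → (suc (below q S) <ᵇ suc (below q' S)) ≡ (q <ᵇ q')
rank-compare S q q' m m' q≢q' with <-cmp q q'
... | tri< q<q' _ _ rewrite <ᵇ-true q<q' = <ᵇ-true (s≤s (below-strict S m q<q'))
... | tri≈ _ q≡q' _ = ⊥-elim (q≢q' q≡q')
... | tri> _ _ q'<q rewrite <ᵇ-false (<⇒≯ q'<q) = <ᵇ-false (λ h → <-irrefl refl (<-trans (≤-pred h) (below-strict S m' q'<q)))

subword-charge : ∀ w m (S : List ℕ) (q : ℕ → ℕ) → Ascending S →
  (∀ k → 1 ≤ k → k ≤ m → (q k ∈ S) × (at w (q k) ≡ k)) →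
  (∀ k → 1 ≤ k → k ≤ m → ∀ {s} → s ∈ S → at w s ≡ k → s ≡ q k) →
  All (InRange m) (map (at w) S) →
  chargePerm (map (at w) S) ≡ chargeSum (λ k → ι (q (pred k) <ᵇ q k)) m
subword-charge w m S q asc hits unique letters =
  maj-reverse (invPerm π)
  ∙ cong (λ L → majRev (map position (oneTo L))) length-π
  ∙ majRev-ascents m position
  ∙ chargeSum-cong _ _ m ascent
  where
  π : List ℕ
  π = map (at w) S
  position : ℕ → ℕ
  position k = indexOf k π

  once : ∀ k → 1 ≤ k → k ≤ m → count k π ≡ 1
  once k 1≤k k≤m = count-map (at w) k S ∙ cong length (filter-cong _ _ S (All.tabulate same-test))
                  ∙ sym (count-map id (q k) S) ∙ cong (count (q k)) (map-id S) ∙ count-ascending asc (proj₁ (hits k 1≤k k≤m))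
    where
    same-test : ∀ {s} → s ∈ S → (at w s ≡ᵇ k) ≡ (s ≡ᵇ q k)
    same-test {s} s∈S with s ≡ᵇ q k in e
    ... | true  = ≡ᵇ-true (cong (at w) (≡ᵇ-true⁻¹ e) ∙ proj₂ (hits k 1≤k k≤m))
    ... | false = ≡ᵇ-false (λ e' → ≡ᵇ-false⁻¹ e (unique k 1≤k k≤m s∈S e'))

  length-π : length π ≡ m
  length-π = length-by-letter m π letters ∙ sumTo-cong _ _ m once ∙ sumTo-const 1 m ∙ *-identityʳ m

  position-rank : ∀ k → 1 ≤ k → k ≤ m → position k ≡ suc (below (q k) S)
  position-rank k 1≤k k≤m = indexOf-rank w k (q k) S asc (proj₁ (hits k 1≤k k≤m)) (proj₂ (hits k 1≤k k≤m)) (unique k 1≤k k≤m)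

  ascent : ∀ k → 2 ≤ k → k ≤ m → ι (position (pred k) <ᵇ position k) ≡ ι (q (pred k) <ᵇ q k)
  ascent (suc zero) (s≤s ()) _
  ascent (suc (suc j)) _ k≤m =
    cong ι (cong₂ _<ᵇ_ (position-rank (suc j) (s≤s z≤n) (<⇒≤ k≤m)) (position-rank (suc (suc j)) (s≤s z≤n) k≤m)
            ∙ rank-compare S (q (suc j)) (q (suc (suc j))) (proj₁ (hits (suc j) (s≤s z≤n) (<⇒≤ k≤m))) (proj₁ (hits (suc (suc j)) (s≤s z≤n) k≤m)) distinct)
    where
    distinct : ¬ (q (suc j) ≡ q (suc (suc j)))
    distinct e = <-irrefl (sym (proj₂ (hits (suc j) (s≤s z≤n) (<⇒≤ k≤m))) ∙ cong (at w) e ∙ proj₂ (hits (suc (suc j)) (s≤s z≤n) k≤m)) (n<1+n (suc j))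

length≡0 : ∀ (l : List ℕ) → length l ≡ 0 → l ≡ []
length≡0 [] _ = refl

at-nonzero : ∀ w i → ¬ (at w i ≡ 0) → i < length w
at-nonzero []      i       h = ⊥-elim (h refl)
at-nonzero (x ∷ w) zero    h = s≤s z≤n
at-nonzero (x ∷ w) (suc i) h = s≤s (at-nonzero w i h)

memᵇ-index : ∀ i l → memᵇ i l ≡ true → Σ ℕ (λ j → (j < length l) × (at l j ≡ i))
memᵇ-index i (x ∷ l) e with i ≡ᵇ x in ex
... | true  = 0 , s≤s z≤n , sym (≡ᵇ-true⁻¹ ex)
... | false with memᵇ-index i l e
...   | j , j<l , lj≡i = suc j , s≤s j<l , lj≡i

memᵇ-at : ∀ j l → j < length l → memᵇ (at l j) l ≡ true
memᵇ-at zero    (x ∷ l) h rewrite ≡ᵇ-true {x} refl = refl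
memᵇ-at (suc j) (x ∷ l) h with at l j ≡ᵇ x
... | true  = refl
... | false = memᵇ-at j l (≤-pred h)

-- The loop keeps the following invariant on the unused positions
-- avail: every letter is left c times, and W k is the maximal excess of the
-- letters k-1 over the letters k in the prefixes of the unused part.
module Extraction (w : List ℕ) (m : ℕ) (m≥1 : 1 ≤ m) (m≤L : m ≤ length w) where

  prefixCount : ℕ → List ℕ → ℕ → ℕ
  prefixCount k avail X = below X (withLetter w k avail)

  record Invariant (c : ℕ) (avail : List ℕ) (W : ℕ → ℕ) : Set where
    field
      ascending : Ascending avail
      balanced  : ∀ k → 1 ≤ k → k ≤ m → length (withLetter w k avail) ≡ c
      bounded   : withLetter w (suc m) avail ≡ []
      excess    : ∀ k → 2 ≤ k → k ≤ m → MaxExcess (prefixCount (pred k) avail) (prefixCount k avail) (W k)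

  module Step (avail : List ℕ) (c : ℕ) (W : ℕ → ℕ) (inv : Invariant (suc c) avail W) where
    open Invariant inv

    first : Σ ℕ (λ q → lastM (withLetter w 1 avail) ≡ just q)
    first with withLetter w 1 avail | balanced 1 ≤-refl m≥1
    ... | x ∷ l | _ = lastM-∷ x l

    trail : List ℕ
    trail = collect (length w) w avail 2 (proj₁ first)

    sel : List ℕ
    sel = proj₁ first ∷ trail

    extracted : extract w avail ≡ sel
    extracted = extract-found w avail (proj₁ first) (proj₂ first)

    length-sel : length sel ≡ m
    length-sel =
      cong suc (collect-length w avail m (length w) 2 (proj₁ first) (s≤s m≥1) enough-fuel
                 (λ j 2≤j j≤m → subst (0 <_) (sym (balanced j (≤-trans (s≤s z≤n) 2≤j) j≤m)) (s≤s z≤n)) bounded)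
      ∙ m+[n∸m]≡n m≥1
      where
      enough-fuel : suc m ≤ length w + 2
      enough-fuel = ≤-trans (s≤s m≤L) (≤-trans (n≤1+n _) (≤-reflexive (+-comm 2 (length w))))

    q : ℕ → ℕ
    q k = at sel (pred k)

    selected : ∀ j → j < m → q (suc j) ∈ withLetter w (suc j) avail
    moves    : ∀ j → suc j < m →
      (q (2 + j) ∈ withLetter w (2 + j) avail) × NextStep (withLetter w (2 + j) avail) (q (suc j)) (q (2 + j))

    selected zero    h = lastM-∈ _ (proj₂ first)
    selected (suc j) h = proj₁ (moves j h)

    moves j h = nextPos-spec w (2 + j) avail (q (suc j)) ascending not-next
                  (Trail-at (collect-trail (length w) w avail 2 (proj₁ first)) j j<trail)
      where
      not-next : ¬ (at w (q (suc j)) ≡ 2 + j)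
      not-next e = <-irrefl (sym (proj₁ (withLetter-∈ w (suc j) avail (selected j (<-trans (n<1+n j) h)))) ∙ e) (n<1+n (suc j))
      j<trail : j < length trail
      j<trail = ≤-pred (subst (suc j <_) (sym length-sel) h)

    holds : ∀ k → 1 ≤ k → k ≤ m → at w (q k) ≡ k
    holds (suc j) _ h = proj₁ (withLetter-∈ w (suc j) avail (selected j h))

    selected-iff : ∀ i k → 1 ≤ k → k ≤ m → at w i ≡ k → memᵇ i sel ≡ (i ≡ᵇ q k)
    selected-iff i (suc k) _ k<m e with i ≡ᵇ q (suc k) in e1
    ... | true = subst (λ z → memᵇ z sel ≡ true) (sym (≡ᵇ-true⁻¹ e1)) (memᵇ-at k sel (subst (k <_) (sym length-sel) k<m))
    ... | false with memᵇ i sel in e2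
    ...   | false = refl
    ...   | true with memᵇ-index i sel e2
    ...     | j , j<sel , selj≡i with suc-injective (sym (holds (suc j) (s≤s z≤n) (subst (j <_) length-sel j<sel)) ∙ cong (at w) selj≡i ∙ e)
    ...       | refl = ⊥-elim (≡ᵇ-false⁻¹ e1 (sym selj≡i))

    avail' : List ℕ
    avail' = filterᵇ (unselected sel) avail

    remaining : ∀ k → 1 ≤ k → k ≤ m → withLetter w k avail' ≡ filterᵇ (without (q k)) (withLetter w k avail)
    remaining k 1≤k k≤m =
      filter-comm (λ i → at w i ≡ᵇ k) (unselected sel) avail
      ∙ filter-cong (unselected sel) (without (q k)) (withLetter w k avail)
          (All.tabulate (λ {i} i∈ → cong (λ b → if b then false else true)
                                       (selected-iff i k 1≤k k≤m (proj₁ (withLetter-∈ w k avail i∈)))))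

    once : ∀ k → 1 ≤ k → k ≤ m → count (q k) (withLetter w k avail) ≡ 1
    once (suc j) 1≤k k≤m = count-ascending (withLetter-ascending w (suc j) ascending) (selected j k≤m)

    balanced' : ∀ k → 1 ≤ k → k ≤ m → length (withLetter w k avail') ≡ c
    balanced' k 1≤k k≤m =
      cong length (remaining k 1≤k k≤m)
      ∙ +-cancelʳ-≡ 1 _ _ (sym (length-without (q k) (withLetter w k avail) ∙ cong (length (filterᵇ (without (q k)) (withLetter w k avail)) +_) (once k 1≤k k≤m))
                           ∙ balanced k 1≤k k≤m ∙ +-comm 1 c)

    bounded' : withLetter w (suc m) avail' ≡ []
    bounded' = filter-comm (λ i → at w i ≡ᵇ suc m) (unselected sel) avail ∙ cong (filterᵇ (unselected sel)) bounded

    -- ω k = 1 when the head wrapped around on its way from k-1 to k.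
    ω : ℕ → ℕ
    ω k = ι (q (pred k) <ᵇ q k)

    W' : ℕ → ℕ
    W' k = W k ∸ ω k

    -- How the extraction changes the counting functions of the letters
    -- k-1 = j+1 and k = j+2: the letter k-1 is removed at p = q (k-1), which
    -- holds no k, and the letter k is removed at q k.
    module Consecutive (j : ℕ) (k≤m : suc (suc j) ≤ m) where
      k : ℕ
      k = suc (suc j)
      p : ℕ
      p = q (suc j)
      A : List ℕ
      A = withLetter w (suc j) avail
      B : List ℕ
      B = withLetter w k avail
      fA : ℕ → ℕ
      fA = prefixCount (suc j) avail
      fB : ℕ → ℕ
      fB = prefixCount k avail
      fA' : ℕ → ℕ
      fA' = prefixCount (suc j) avail'
      fB' : ℕ → ℕ
      fB' = prefixCount k avail'

      jumpA : fA (suc p) ≡ suc (fA p)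
      jumpA = below-suc p A ∙ cong (below p A +_) (once (suc j) (s≤s z≤n) (<⇒≤ k≤m)) ∙ +-comm _ 1

      flatB : fB (suc p) ≡ fB p
      flatB = below-suc p B ∙ cong (below p B +_) (count-none p B (All.tabulate not-k)) ∙ +-identityʳ _
        where
        not-k : ∀ {y} → y ∈ B → ¬ (y ≡ p)
        not-k y∈B y≡p = <-irrefl (sym (holds (suc j) (s≤s z≤n) (<⇒≤ k≤m)) ∙ cong (at w) (sym y≡p) ∙ proj₁ (withLetter-∈ w k avail y∈B)) (n<1+n (suc j))

      splitA : ∀ X → fA X ≡ fA' X + ι (p <ᵇ X)
      splitA X = below-without X p A ∙ cong₂ _+_ (cong (below X) (sym (remaining (suc j) (s≤s z≤n) (<⇒≤ k≤m))))
                                                  (cong (λ c → if p <ᵇ X then c else 0) (once (suc j) (s≤s z≤n) (<⇒≤ k≤m)))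

      splitB : ∀ X → fB X ≡ fB' X + ι (q k <ᵇ X)
      splitB X = below-without X (q k) B ∙ cong₂ _+_ (cong (below X) (sym (remaining k (s≤s z≤n) k≤m)))
                                                      (cong (λ c → if q k <ᵇ X then c else 0) (once k (s≤s z≤n) k≤m))

    excess' : ∀ k → 2 ≤ k → k ≤ m → MaxExcess (prefixCount (pred k) avail') (prefixCount k avail') (W' k) × (W k ≡ ω k + W' k)
    excess' (suc zero) (s≤s ()) _
    excess' (suc (suc j)) 2≤k k≤m = update (proj₂ (moves j k≤m))
      where
      open Consecutive j k≤m
      update : NextStep B p (q k) → MaxExcess fA' fB' (W' k) × (W k ≡ ω k + W' k)
      update (leftward q<p flat) =
        subst (λ z → MaxExcess fA' fB' (W k ∸ z)) (sym no-wrap)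
          (maxExcess-leftward fA fB fA' fB' p (q k) (W k) (below-mono A) (below-mono B) jumpA flatB q<p flat splitA splitB (excess k 2≤k k≤m))
        , sym (cong₂ (λ a b → a + (W k ∸ b)) no-wrap no-wrap)
        where
        no-wrap : ω k ≡ 0
        no-wrap = cong ι (<ᵇ-false (<⇒≯ q<p))
      update (wrapped p<q none-before last)
        with maxExcess-wrapped fA fB fA' fB' p (q k) (W k) (length A) (length B) (below-mono A) (below-mono B) jumpA flatB p<q none-before last
               (λ X → below-≤-length X B) (λ X → below-≤-length X A) (balanced (suc j) (s≤s z≤n) (<⇒≤ k≤m) ∙ sym (balanced k (s≤s z≤n) k≤m))
               splitA splitB (excess k 2≤k k≤m)
      ... | V , W≡1+V , max' =
        subst (MaxExcess fA' fB') (sym W'≡V) max' , W≡1+V ∙ cong suc (sym W'≡V) ∙ cong (_+ W' k) (sym wrap)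
        where
        wrap : ω k ≡ 1
        wrap = cong ι (<ᵇ-true p<q)
        W'≡V : W' k ≡ V
        W'≡V = cong₂ _∸_ W≡1+V wrap

    invariant' : Invariant c avail' W'
    invariant' = record { ascending = Ascending-filter (unselected sel) ascending ; balanced = balanced'
                        ; bounded = bounded' ; excess = λ k 2≤k k≤m → proj₁ (excess' k 2≤k k≤m) }

    selection : List ℕ
    selection = filterᵇ (λ i → memᵇ i sel) (upTo (length w))

    in-selection : ∀ {s} → s ∈ selection → memᵇ s sel ≡ true
    in-selection = All.lookup (filter-sat _ (upTo (length w)))

    hits : ∀ k → 1 ≤ k → k ≤ m → (q k ∈ selection) × (at w (q k) ≡ k)
    hits (suc j) 1≤k k≤m =
      ∈-filter _ (upTo (length w)) (∈-upTo⁺ (at-nonzero w (q (suc j)) (λ e → 1+n≢0 (sym (holds (suc j) 1≤k k≤m) ∙ e))))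
                                   (memᵇ-at j sel (subst (j <_) (sym length-sel) k≤m))
      , holds (suc j) 1≤k k≤m

    unique : ∀ k → 1 ≤ k → k ≤ m → ∀ {s} → s ∈ selection → at w s ≡ k → s ≡ q k
    unique k 1≤k k≤m s∈ e = ≡ᵇ-true⁻¹ (sym (selected-iff _ k 1≤k k≤m e) ∙ in-selection s∈)

    letters : All (InRange m) (map (at w) selection)
    letters = map⁺ (All.tabulate letter)
      where
      letter : ∀ {s} → s ∈ selection → InRange m (at w s)
      letter s∈ with memᵇ-index _ sel (in-selection s∈)
      ... | j , j<sel , selj≡s = subst (InRange m) (sym (cong (at w) (sym selj≡s) ∙ holds (suc j) (s≤s z≤n) j<m)) (s≤s z≤n , j<m)
        where
        j<m : j < m
        j<m = subst (j <_) length-sel j<sel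

    subword-charge-ω : chargePerm (subwordOf w sel) ≡ chargeSum ω m
    subword-charge-ω = subword-charge w m selection q (Ascending-filter _ (Ascending-upTo (length w))) hits unique letters

  -- Running the loop from an invariant state accumulates the maximal excesses:
  -- the k-th excess counts the wraps from k-1 to k over all extracted subwords.
  chargeLoop-excess : ∀ c fuel avail W → c ≤ fuel → Invariant c avail W → chargeLoop fuel w avail ≡ chargeSum W m
  chargeLoop-excess zero fuel avail W _ inv =
    chargeLoop-done fuel w avail (extract-none w avail (cong lastM (no-letter 1 ≤-refl m≥1)))
    ∙ sym (chargeSum-cong W (λ _ → 0) m excess-zero ∙ chargeSum-zero m)
    where
    open Invariant inv
    no-letter : ∀ k → 1 ≤ k → k ≤ m → withLetter w k avail ≡ []
    no-letter k 1≤k k≤m = length≡0 _ (balanced k 1≤k k≤m)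
    excess-zero : ∀ k → 2 ≤ k → k ≤ m → W k ≡ 0
    excess-zero (suc zero) (s≤s ()) _
    excess-zero (suc (suc j)) 2≤k k≤m =
      maxExcess-empty (prefixCount (suc j) avail) (prefixCount (suc (suc j)) avail) (W (suc (suc j)))
        (λ X → cong (below X) (no-letter (suc j) (s≤s z≤n) (<⇒≤ k≤m))) (λ X → cong (below X) (no-letter (suc (suc j)) (s≤s z≤n) k≤m))
        (excess (suc (suc j)) 2≤k k≤m)
  chargeLoop-excess (suc c) zero avail W () inv
  chargeLoop-excess (suc c) (suc fuel) avail W c<fuel inv =
    chargeLoop-step fuel w avail (proj₁ first) trail extracted
    ∙ cong₂ _+_ subword-charge-ω (chargeLoop-excess c fuel avail' W' (≤-pred c<fuel) invariant')
    ∙ sym (chargeSum-+ ω W' m)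
    ∙ chargeSum-cong _ _ m (λ k 2≤k k≤m → sym (proj₂ (excess' k 2≤k k≤m)))
    where open Step avail c W inv

filter-map-suc : ∀ (p : ℕ → Bool) U → filterᵇ p (map suc U) ≡ map suc (filterᵇ (λ i → p (suc i)) U)
filter-map-suc p [] = refl
filter-map-suc p (x ∷ U) with p (suc x)
... | true  = cong (suc x ∷_) (filter-map-suc p U)
... | false = filter-map-suc p U

withLetter-∷ : ∀ x w k → withLetter (x ∷ w) k (upTo (suc (length w))) ≡
  (if x ≡ᵇ k then 0 ∷ map suc (withLetter w k (upTo (length w))) else map suc (withLetter w k (upTo (length w))))
withLetter-∷ x w k = cong (λ F → if x ≡ᵇ k then 0 ∷ F else F)
  (cong (filterᵇ (λ i → at (x ∷ w) i ≡ᵇ k)) (sym (map-upTo suc (length w))) ∙ filter-map-suc (λ i → at (x ∷ w) i ≡ᵇ k) (upTo (length w)))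

below-map-suc : ∀ X V → below (suc X) (map suc V) ≡ below X V
below-map-suc X V = cong length (filter-map-suc (λ i → i <ᵇ suc X) V) ∙ length-map suc (filterᵇ (λ i → i <ᵇ X) V)

below-zero : ∀ V → below 0 V ≡ 0
below-zero []      = refl
below-zero (x ∷ V) = below-zero V

initial-prefixCount : ∀ w X k → below X (withLetter w k (upTo (length w))) ≡ count k (take X w)
initial-prefixCount []      zero    k = refl
initial-prefixCount []      (suc X) k = refl
initial-prefixCount (x ∷ w) zero    k = below-zero (withLetter (x ∷ w) k (upTo (length (x ∷ w))))
initial-prefixCount (x ∷ w) (suc X) k rewrite withLetter-∷ x w k with x ≡ᵇ k
... | true  = cong suc (below-map-suc X (withLetter w k (upTo (length w))) ∙ initial-prefixCount w X k)
... | false = below-map-suc X (withLetter w k (upTo (length w))) ∙ initial-prefixCount w X k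

initial-count : ∀ w k → length (withLetter w k (upTo (length w))) ≡ count k w
initial-count []      k = refl
initial-count (x ∷ w) k rewrite withLetter-∷ x w k with x ≡ᵇ k
... | true  = cong suc (length-map suc (withLetter w k (upTo (length w))) ∙ initial-count w k)
... | false = length-map suc (withLetter w k (upTo (length w))) ∙ initial-count w k

MaxExcess-ext : ∀ {f f' g g' : ℕ → ℕ} {W} → (∀ X → f X ≡ f' X) → (∀ X → g X ≡ g' X) → MaxExcess f g W → MaxExcess f' g' W
MaxExcess-ext {W = W} ef eg (bound , X₀ , attained) =
  (λ X → subst₂ _≤_ (ef X) (cong (_+ W) (eg X)) (bound X)) , X₀ , sym (ef X₀) ∙ attained ∙ cong (_+ W) (eg X₀)

chargeWord-excess : ∀ w m c (E : ℕ → ℕ) → 1 ≤ m → 1 ≤ c →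
  (∀ k → 1 ≤ k → k ≤ m → count k w ≡ c) → count (suc m) w ≡ 0 →
  (∀ k → 2 ≤ k → k ≤ m → MaxExcess (λ X → count (pred k) (take X w)) (λ X → count k (take X w)) (E k)) →
  chargeWord w ≡ chargeSum E m
chargeWord-excess w m c E m≥1 c≥1 counts no-larger excess =
  chargeLoop-excess c (length w) (upTo (length w)) E c≤length initial
  where
  m*c≤length : m * c ≤ length w
  m*c≤length = subst (_≤ length w) (sumTo-cong _ _ m counts ∙ sumTo-const c m)
                     (subst (sumTo (λ k → count k w) m ≤_) (sym (length-outside m w)) (m≤m+n _ (outside m w)))
  m≤length : m ≤ length w
  m≤length = ≤-trans (subst (_≤ m * c) (*-identityʳ m) (*-monoʳ-≤ m c≥1)) m*c≤length
  c≤length : c ≤ length w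
  c≤length = ≤-trans (subst (_≤ m * c) (*-identityˡ c) (*-monoˡ-≤ c m≥1)) m*c≤length
  open Extraction w m m≥1 m≤length
  initial : Invariant c (upTo (length w)) E
  initial = record
    { ascending = Ascending-upTo (length w)
    ; balanced  = λ k 1≤k k≤m → initial-count w k ∙ counts k 1≤k k≤m
    ; bounded   = length≡0 _ (initial-count w (suc m) ∙ no-larger)
    ; excess    = λ k 2≤k k≤m → MaxExcess-ext (λ X → sym (initial-prefixCount w X (pred k))) (λ X → sym (initial-prefixCount w X k)) (excess k 2≤k k≤m)
    }

-- Column strictness bounds the excess in prefixes ending in
-- the lower rows; prefixes of the first row are handled by sortedness.

concat-reverse-∷ : ∀ (r : List ℕ) rs → concat (reverse (r ∷ rs)) ≡ concat (reverse rs) ++ r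
concat-reverse-∷ r rs = cong concat (reverse-++ (r ∷ []) rs) ∙ sym (concat-++ (reverse rs) (r ∷ [])) ∙ cong (concat (reverse rs) ++_) (++-identityʳ r)

take-++-≤ : ∀ X (u v : List ℕ) → X ≤ length u → take X (u ++ v) ≡ take X u
take-++-≤ zero    u       v h       = refl
take-++-≤ (suc X) (x ∷ u) v (s≤s h) = cong (x ∷_) (take-++-≤ X u v h)

drop-++-≤ : ∀ X (u v : List ℕ) → X ≤ length u → drop X (u ++ v) ≡ drop X u ++ v
drop-++-≤ zero    u       v h       = refl
drop-++-≤ (suc X) (x ∷ u) v (s≤s h) = drop-++-≤ X u v h

take-++-+ : ∀ Y (u v : List ℕ) → take (length u + Y) (u ++ v) ≡ u ++ take Y v
take-++-+ Y []      v = refl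
take-++-+ Y (x ∷ u) v = cong (x ∷_) (take-++-+ Y u v)

drop-++-+ : ∀ Y (u v : List ℕ) → drop (length u + Y) (u ++ v) ≡ drop Y v
drop-++-+ Y []      v = refl
drop-++-+ Y (x ∷ u) v = drop-++-+ Y u v

data WeaklyIncreasing : List ℕ → Set where
  []  : WeaklyIncreasing []
  _∷_ : ∀ {x xs} → All (x ≤_) xs → WeaklyIncreasing xs → WeaklyIncreasing (x ∷ xs)

weaklyIncreasing-row : ∀ r → (∀ j → suc j < length r → at r j ≤ at r (suc j)) → WeaklyIncreasing r
weaklyIncreasing-row []          h = []
weaklyIncreasing-row (x ∷ [])    h = [] ∷ []
weaklyIncreasing-row (x ∷ y ∷ r) h with weaklyIncreasing-row (y ∷ r) (λ j hj → h (suc j) (s≤s hj))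
... | a ∷ inc = (h 0 (s≤s (s≤s z≤n)) ∷ All.map (≤-trans (h 0 (s≤s (s≤s z≤n)))) a) ∷ (a ∷ inc)

prefix-below : ∀ v y r → WeaklyIncreasing r → count v (take (below y r) r) ≡ (if v <ᵇ y then count v r else 0)
prefix-below v y [] [] with v <ᵇ y
... | true  = refl
... | false = refl
prefix-below v y (x ∷ r) (a ∷ inc) with x <ᵇ y in x<y
... | true rewrite prefix-below v y r inc with v <ᵇ y in v<y
...   | true  = refl
...   | false rewrite ≡ᵇ-false {x} {v} (λ x≡v → <ᵇ-false⁻¹ v<y (subst (_< y) x≡v (<ᵇ-true⁻¹ x<y))) = refl
prefix-below v y (x ∷ r) (a ∷ inc) | false
  rewrite below-none y r (All.map (≤-trans (≮⇒≥ (<ᵇ-false⁻¹ x<y))) a) with v <ᵇ y in v<y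
... | false = refl
... | true  = sym (count-none v (x ∷ r) (All.map (λ y≤z z≡v → <⇒≱ (<ᵇ-true⁻¹ v<y) (subst (y ≤_) z≡v y≤z)) at-least-y))
  where
  at-least-y : All (y ≤_) (x ∷ r)
  at-least-y = ≮⇒≥ (<ᵇ-false⁻¹ x<y) ∷ All.map (≤-trans (≮⇒≥ (<ᵇ-false⁻¹ x<y))) a

data StrictlyAbove : List ℕ → List ℕ → Set where
  []  : ∀ {u} → StrictlyAbove u []
  _∷_ : ∀ {x y u l} → x < y → StrictlyAbove u l → StrictlyAbove (x ∷ u) (y ∷ l)

above-row : ∀ u l → length l ≤ length u → (∀ j → j < length l → at u j < at l j) → StrictlyAbove u l
above-row u       []      h1       h2 = []
above-row (x ∷ u) (y ∷ l) (s≤s h1) h2 = h2 0 (s≤s z≤n) ∷ above-row u l h1 (λ j hj → h2 (suc j) (s≤s hj))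

above-below : ∀ v u l → StrictlyAbove u l → below (suc v) l ≤ below v u
above-below v u [] [] = z≤n
above-below v (x ∷ u) (y ∷ l) (x<y ∷ a) rewrite below-∷ (suc v) y l | below-∷ v x u = +-mono-≤ column (above-below v u l a)
  where
  column : ι (y <ᵇ suc v) ≤ ι (x <ᵇ v)
  column with y <ᵇ suc v in e
  ... | false = z≤n
  ... | true rewrite <ᵇ-true (<-≤-trans x<y (≤-pred (<ᵇ-true⁻¹ e))) = ≤-refl

data ColumnStrict : List (List ℕ) → Set where
  []     : ColumnStrict []
  single : ∀ {r} → ColumnStrict (r ∷ [])
  _∷_    : ∀ {u l rs} → StrictlyAbove u l → ColumnStrict (l ∷ rs) → ColumnStrict (u ∷ l ∷ rs)

columnStrict-rows : ∀ Ts → (∀ i → length (rowAt Ts (suc i)) ≤ length (rowAt Ts i)) →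
  (∀ i j → j < length (rowAt Ts (suc i)) → at (rowAt Ts i) j < at (rowAt Ts (suc i)) j) → ColumnStrict Ts
columnStrict-rows []           h1 h2 = []
columnStrict-rows (r ∷ [])     h1 h2 = single
columnStrict-rows (u ∷ l ∷ rs) h1 h2 = above-row u l (h1 0) (h2 0) ∷ columnStrict-rows (l ∷ rs) (λ i → h1 (suc i)) (λ i → h2 (suc i))

ColumnStrict-tail : ∀ {r rs} → ColumnStrict (r ∷ rs) → ColumnStrict rs
ColumnStrict-tail single  = []
ColumnStrict-tail (_ ∷ c) = c

rows-below-bound : ∀ v r rest → ColumnStrict (r ∷ rest) → count v (concat (reverse rest)) ≤ below v r
rows-below-bound v r [] c = z≤n
rows-below-bound v r (r' ∷ rest) (ab ∷ c) rewrite concat-reverse-∷ r' rest | count-++ v (concat (reverse rest)) r' =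
  ≤-trans (+-monoˡ-≤ (count v r') (rows-below-bound v r' rest c)) (≤-trans (≤-reflexive (sym (below-suc v r'))) (above-below v r r' ab))

-- Cutting the reading word of the rows r, rest at X, the letters v before the
-- cut and the letters v+1 after it fit into distinct columns of r; E accounts
-- for the letters v+1 of the rows above r.
prefix-bound : ∀ n v r rest → ColumnStrict (r ∷ rest) → ∀ X E → E + below (suc (suc v)) r ≤ n →
  E + count v (take X (concat (reverse rest) ++ r)) + count (suc v) (drop X (concat (reverse rest) ++ r)) ≤ n
prefix-bound n v r rest c X E h with <-≤-connex X (length (concat (reverse rest)))
... | inj₂ B≤X = subst (λ Z → E + count v (take Z (B ++ r)) + count (suc v) (drop Z (B ++ r)) ≤ n) (m+[n∸m]≡n B≤X) cut-in-r
  where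
  B : List ℕ
  B = concat (reverse rest)
  Y : ℕ
  Y = X ∸ length B
  cut-in-r : E + count v (take (length B + Y) (B ++ r)) + count (suc v) (drop (length B + Y) (B ++ r)) ≤ n
  cut-in-r rewrite take-++-+ Y B r | drop-++-+ Y B r | count-++ v B (take Y r) =
    ≤-trans (+-mono-≤ (+-monoʳ-≤ E (+-mono-≤ (rows-below-bound v r rest c) (count-take-≤ v Y r))) (count-drop-≤ (suc v) Y r))
            (≤-trans (≤-reflexive letters-of-r) h)
    where
    letters-of-r : E + (below v r + count v r) + count (suc v) r ≡ E + below (suc (suc v)) r
    letters-of-r = +-assoc E _ _ ∙ cong (E +_) (cong (_+ count (suc v) r) (sym (below-suc v r)) ∙ sym (below-suc (suc v) r))
prefix-bound n v r [] c X E h | inj₁ ()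
prefix-bound n v r (r' ∷ rest) (ab ∷ c) X E h | inj₁ X<B rewrite concat-reverse-∷ r' rest
    | take-++-≤ X (concat (reverse rest) ++ r') r (<⇒≤ X<B)
    | drop-++-≤ X (concat (reverse rest) ++ r') r (<⇒≤ X<B)
    | count-++ (suc v) (drop X (concat (reverse rest) ++ r')) r =
  ≤-trans (≤-reflexive (shuffle E a d s)) (prefix-bound n v r' rest c X (E + s) h')
  where
  B' : List ℕ
  B' = concat (reverse rest) ++ r'
  a : ℕ
  a = count v (take X B')
  d : ℕ
  d = count (suc v) (drop X B')
  s : ℕ
  s = count (suc v) r
  h' : E + s + below (suc (suc v)) r' ≤ n
  h' = ≤-trans (+-monoʳ-≤ (E + s) (above-below (suc v) r r' ab))
         (≤-trans (≤-reflexive (+-assoc E s _ ∙ cong (E +_) (+-comm s _ ∙ sym (below-suc (suc v) r)))) h)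
  shuffle : ∀ E a d s → E + a + (d + s) ≡ E + s + a + d
  shuffle = solve-∀

rows-prefix-bound : ∀ n v row₀ Rs → ColumnStrict (row₀ ∷ Rs) → All (λ r → length r ≡ n) Rs → ∀ X → X ≤ length (concat (reverse Rs)) →
   count v (take X (concat (reverse Rs))) + count (suc v) (drop X (concat (reverse Rs))) ≤ n
rows-prefix-bound n v row₀ [] ch lens zero h = z≤n
rows-prefix-bound n v row₀ (r ∷ rest) ch (r≡n ∷ _) X h rewrite concat-reverse-∷ r rest =
  prefix-bound n v r rest (ColumnStrict-tail ch) X 0 (subst (below (suc (suc v)) r ≤_) r≡n (below-≤-length (suc (suc v)) r))

tableau-excess : ∀ n v row₀ Rs → ColumnStrict (row₀ ∷ Rs) → All (λ r → length r ≡ n) Rs → WeaklyIncreasing row₀ →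
  count v (concat (reverse Rs) ++ row₀) ≡ n → count (suc v) (concat (reverse Rs) ++ row₀) ≡ n →
  MaxExcess (λ X → count v (take X (concat (reverse Rs) ++ row₀))) (λ X → count (suc v) (take X (concat (reverse Rs) ++ row₀))) (count (suc v) row₀)
tableau-excess n v row₀ Rs ch lens inc count-v count-v+1 = bound , X₀ , attained
  where
  lower : List ℕ
  lower = concat (reverse Rs)
  w : List ℕ
  w = lower ++ row₀
  t : ℕ
  t = count (suc v) row₀
  split-v+1 : count (suc v) lower + t ≡ n
  split-v+1 = sym (count-++ (suc v) lower row₀) ∙ count-v+1
  bound : ∀ X → count v (take X w) ≤ count (suc v) (take X w) + t
  bound X with ≤-<-connex X (length lower)
  ... | inj₁ X≤lower rewrite take-++-≤ X lower row₀ X≤lower =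
    +-cancelʳ-≤ (count (suc v) (drop X lower)) _ _
      (≤-trans (rows-prefix-bound n v row₀ Rs ch lens X X≤lower)
               (≤-reflexive (sym split-v+1 ∙ cong (_+ t) (count-take-drop (suc v) X lower) ∙ swap (count (suc v) (take X lower)) (count (suc v) (drop X lower)) t)))
    where
    swap : ∀ x y z → x + y + z ≡ x + z + y
    swap = solve-∀
  ... | inj₂ lower<X =
    ≤-trans (count-take-≤ v X w) (≤-trans (≤-reflexive (count-v ∙ sym count-v+1 ∙ count-take-drop (suc v) X w))
                                          (+-monoʳ-≤ (count (suc v) (take X w)) rest-in-row₀))
    where
    rest-in-row₀ : count (suc v) (drop X w) ≤ t
    rest-in-row₀ = subst (λ Z → count (suc v) (drop Z w) ≤ t) (m+[n∸m]≡n (<⇒≤ lower<X))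
                     (subst (_≤ t) (sym (cong (count (suc v)) (drop-++-+ (X ∸ length lower) lower row₀)))
                            (count-drop-≤ (suc v) (X ∸ length lower) row₀))
  -- The maximum is attained just before the first v+1 of the first row.
  X₀ : ℕ
  X₀ = length lower + below (suc v) row₀
  attained : count v (take X₀ w) ≡ count (suc v) (take X₀ w) + t
  attained rewrite take-++-+ (below (suc v) row₀) lower row₀ | count-++ v lower (take (below (suc v) row₀) row₀)
     | count-++ (suc v) lower (take (below (suc v) row₀) row₀) | prefix-below v (suc v) row₀ inc | prefix-below (suc v) (suc v) row₀ inc
     | <ᵇ-true (n<1+n v) | <ᵇ-false (<-irrefl {suc v} refl) =
     sym (count-++ v lower row₀) ∙ count-v ∙ sym split-v+1 ∙ cong (_+ t) (sym (+-identityʳ _))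

-- Complementing the weights m+1-k of chargeSum with the weights k of the
-- letters themselves gives the uniform weight m+1:
-- Σ_{k≥2} (m+1-k) t k + m · t 1 + Σ_k k · t k = (m+1) Σ_k t k.
chargeSum-complement : ∀ t m → chargeSum t m + m * t 1 ≡ sumTo (λ k → (suc m ∸ k) * t k) m
chargeSum-complement t zero          = refl
chargeSum-complement t (suc zero)    = sym (+-identityʳ (1 * t 1))
chargeSum-complement t (suc (suc m)) =
  rearrange (t 2) (chargeSum (λ k → t (suc k)) (suc m)) (t 1) (suc m)
  ∙ cong (suc (suc m) * t 1 +_) (chargeSum-complement (λ k → t (suc k)) (suc m))
  where
  rearrange : ∀ x g y s → x * s + g + suc s * y ≡ suc s * y + (g + s * x)
  rearrange = solve-∀

chargeSum-weights : ∀ t m → chargeSum t m + m * t 1 + sumTo (λ k → k * t k) m ≡ suc m * sumTo t m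
chargeSum-weights t m =
  cong (_+ sumTo (λ k → k * t k) m) (chargeSum-complement t m)
  ∙ sym (sumTo-+ _ _ m)
  ∙ sumTo-cong _ _ m (λ k _ k≤m → sym (*-distribʳ-+ (t k) (suc m ∸ k) k) ∙ cong (_* t k) (m∸n+n≡m (m≤n⇒m≤1+n k≤m)))
  ∙ sumTo-* (suc m) t m

count-concat-reverse : ∀ k Rs → count k (concat (reverse Rs)) ≡ count k (concat Rs)
count-concat-reverse k [] = refl
count-concat-reverse k (r ∷ rs) =
  cong (count k) (concat-reverse-∷ r rs) ∙ count-++ k (concat (reverse rs)) r
  ∙ cong (_+ count k r) (count-concat-reverse k rs) ∙ +-comm _ (count k r) ∙ sym (count-++ k r (concat rs))

length-concat-reverse : ∀ n Rs → All (λ r → length r ≡ n) Rs → length (concat (reverse Rs)) ≡ length Rs * n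
length-concat-reverse n [] [] = refl
length-concat-reverse n (r ∷ rs) (r≡n ∷ rs≡n) =
  cong length (concat-reverse-∷ r rs) ∙ length-++ (concat (reverse rs))
  ∙ cong₂ _+_ (length-concat-reverse n rs rs≡n) r≡n ∙ +-comm _ n

rows-of-length : ∀ b n (Rs : List (List ℕ)) → map length Rs ≡ replicate b n → All (λ r → length r ≡ n) Rs
rows-of-length b       n []       e = []
rows-of-length (suc b) n (r ∷ Rs) e = proj₁ (∷-injective e) ∷ rows-of-length b n Rs (proj₂ (∷-injective e))

length-rowAt : ∀ Ts i → length (rowAt Ts i) ≡ at (map length Ts) i
length-rowAt []       i       = refl
length-rowAt (r ∷ Ts) zero    = refl
length-rowAt (r ∷ Ts) (suc i) = length-rowAt Ts i

at-replicate-≤ : ∀ b n i → at (replicate b n) i ≤ n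
at-replicate-≤ zero    n i       = z≤n
at-replicate-≤ (suc b) n zero    = ≤-refl
at-replicate-≤ (suc b) n (suc i) = at-replicate-≤ b n i

at-replicate-anti : ∀ b n i → at (replicate b n) (suc i) ≤ at (replicate b n) i
at-replicate-anti zero    n i       = z≤n
at-replicate-anti (suc b) n zero    = at-replicate-≤ b n 0
at-replicate-anti (suc b) n (suc i) = at-replicate-anti b n i

module SHSTTableau (a b n : ℕ) (n≥1 : 1 ≤ n) (row₀ : List ℕ) (Rs : List (List ℕ)) (T∈ : SHST a b n (row₀ ∷ Rs)) where
  open SHST T∈
  open IsSSYT ssyt

  m : ℕ
  m = a + b + 1

  lower : List ℕ
  lower = concat (reverse Rs)

  word : List ℕ
  word = lower ++ row₀

  reading : readingWord (row₀ ∷ Rs) ≡ word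
  reading = concat-reverse-∷ row₀ Rs

  length-row₀ : length row₀ ≡ n * (a + 1)
  length-row₀ = proj₁ (∷-injective shape)

  lower-rows : All (λ r → length r ≡ n) Rs
  lower-rows = rows-of-length b n Rs (proj₂ (∷-injective shape))

  columns : ColumnStrict (row₀ ∷ Rs)
  columns = columnStrict-rows (row₀ ∷ Rs) shorter colStrict
    where
    shorter : ∀ i → length (rowAt (row₀ ∷ Rs) (suc i)) ≤ length (rowAt (row₀ ∷ Rs) i)
    shorter i rewrite length-rowAt (row₀ ∷ Rs) (suc i) | length-rowAt (row₀ ∷ Rs) i | proj₂ (∷-injective shape) | length-row₀ with i
    ... | zero   = ≤-trans (at-replicate-≤ b n 0) (subst (_≤ n * (a + 1)) (*-identityʳ n) (*-monoʳ-≤ n (m≤n+m 1 a)))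
    ... | suc i' = at-replicate-anti b n i'

  counts : ∀ k → 1 ≤ k → k ≤ m → count k word ≡ n
  counts k 1≤k k≤m = cong (count k) (sym reading) ∙ count-concat-reverse k (row₀ ∷ Rs) ∙ content k 1≤k k≤m

  length-word : length word ≡ m * n
  length-word =
    length-++ lower ∙ cong₂ _+_ (length-concat-reverse n Rs lower-rows ∙ cong (_* n) (length-rows)) length-row₀ ∙ total a b n
    where
    length-rows : length Rs ≡ b
    length-rows = sym (length-map (length {A = ℕ}) Rs) ∙ cong length (proj₂ (∷-injective shape)) ∙ length-replicate b
    total : ∀ a b n → b * n + n * (a + 1) ≡ (a + b + 1) * n
    total = solve-∀

  letters : All (InRange m) word
  letters = alphabet-exhausted m n word length-word counts

  letters₀ : All (InRange m) row₀
  letters₀ = ++⁻ʳ lower letters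

  -- All ones sit in the first row: a 1 below it would need a smaller entry above.
  ones-first-row : count 1 row₀ ≡ n
  ones-first-row = sym (cong (_+ count 1 row₀) no-ones-below) ∙ sym (count-++ 1 lower row₀) ∙ counts 1 ≤-refl (m≤n+m 1 (a + b))
    where
    no-ones-below : count 1 lower ≡ 0
    no-ones-below = n≤0⇒n≡0 (≤-trans (rows-below-bound 1 row₀ Rs columns) (≤-reflexive (below-none 1 row₀ (All.map proj₁ letters₀))))

  charge : chargeT (row₀ ∷ Rs) ≡ chargeSum (λ k → count k row₀) m
  charge = cong chargeWord reading ∙ chargeWord-excess word m n (λ k → count k row₀) (m≤n+m 1 (a + b)) n≥1 counts no-larger excess
    where
    no-larger : count (suc m) word ≡ 0
    no-larger = count-none (suc m) word (All.map (λ x∈ e → <-irrefl refl (subst (_≤ m) e (proj₂ x∈))) letters)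
    excess : ∀ k → 2 ≤ k → k ≤ m → MaxExcess (λ X → count (pred k) (take X word)) (λ X → count k (take X word)) (count k row₀)
    excess (suc zero) (s≤s ()) _
    excess (suc (suc j)) _ k≤m =
      tableau-excess n (suc j) row₀ Rs columns lower-rows (weaklyIncreasing-row row₀ (rowWeak 0))
                     (counts (suc j) (s≤s z≤n) (<⇒≤ k≤m)) (counts (suc (suc j)) (s≤s z≤n) k≤m)

mainTheorem6 : (a b n : ℕ) → 1 ≤ n → (T : List (List ℕ)) → SHST a b n T →
    chargeT T + sum₁ T ≡ ((a + b + 2) * a + 1) * n
mainTheorem6 a b n n≥1 [] T∈ with SHST.shape T∈
... | ()
mainTheorem6 a b n n≥1 (row₀ ∷ Rs) T∈ = +-cancelʳ-≡ (m * n) _ _ (begin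
  chargeT (row₀ ∷ Rs) + sum₁ (row₀ ∷ Rs) + m * n
    ≡⟨ cong₂ (λ x y → x + y + m * n) charge (sum-by-letter-id m row₀ letters₀) ⟩
  chargeSum t m + sumTo (λ k → k * t k) m + m * n
    ≡⟨ cong (λ z → chargeSum t m + sumTo (λ k → k * t k) m + m * z) (sym ones-first-row) ⟩
  chargeSum t m + sumTo (λ k → k * t k) m + m * t 1
    ≡⟨ +-assoc (chargeSum t m) _ _ ∙ cong (chargeSum t m +_) (+-comm _ (m * t 1)) ∙ sym (+-assoc (chargeSum t m) _ _) ⟩
  chargeSum t m + m * t 1 + sumTo (λ k → k * t k) m
    ≡⟨ chargeSum-weights t m ⟩
  suc m * sumTo t m
    ≡⟨ cong (suc m *_) (sym (length-by-letter m row₀ letters₀) ∙ length-row₀) ⟩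
  suc m * (n * (a + 1))
    ≡⟨ total a b n ⟩
  ((a + b + 2) * a + 1) * n + m * n ∎)
  where
  open SHSTTableau a b n n≥1 row₀ Rs T∈
  open ≡-Reasoning
  t : ℕ → ℕ
  t k = count k row₀
  total : ∀ a b n → suc (a + b + 1) * (n * (a + 1)) ≡ ((a + b + 2) * a + 1) * n + (a + b + 1) * n
  total = solve-∀
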